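{- Let $\mathbb Q\langle Z\rangle$ be equipped with the product $\star$ defined below. The $\mathbb Q$-linear evaluation map $[\,\cdot\,]\colon\mathbb Q\langle Z\rangle\to\mathbb Q[[q]]$ given by $[1]=1$ and $$ [z_{s_1,r_1}\dots z_{s_l,r_l}]=\biggl[\begin{matrix} s_1,\dots,s_l \\ r_1-1,\dots,r_l-1 \end{matrix}\biggr] $$ satisfies $[w\star v]=[w]\cdot[v]$ for all $w,v\in\mathbb Q\langle Z\rangle$. Hence it is a homomorphism of the $\mathbb Q$-algebra $(\mathbb Q\langle Z\rangle,\star)$ onto $(\mathrm{BD},\cdot)$, and $\mathrm{BD}$ is a $\mathbb Q$-algebra.
   Context: Bi-brackets: for integers $s_j\ge1$, $r_j\ge0$, $\bigl[\begin{smallmatrix} s_1,\dots,s_l \\ r_1,\dots,r_l \end{smallmatrix}\bigr]:=\frac1{r_1!\,(s_1-1)!\dotsb r_l!\,(s_l-1)!}\sum_{n_1>\dots>n_l>0,\ d_1,\dots,d_l>0} n_1^{r_1}d_1^{s_1-1}\dotsb n_l^{r_l}d_l^{s_l-1}q^{n_1d_1+\dots+n_ld_l}$; $\mathrm{BD}$ denotes the $\mathbb Q$-vector space spanned by all bi-brackets (including the empty one, $=1$). Let $Z=\{z_{s,r}:s,r=1,2,\dots\}$ be an alphabet (letter $z_{s,r}$ has weight $s+r-1$) and $\mathbb Q\langle Z\rangle$ the free noncommutative $\mathbb Q$-algebra of words in $Z$. Let $\lambda_s$ be defined by $\sum_{s\ge0}\lambda_sx^s=-\dfrac{x}{1-e^x}=1+\sum_{s\ge1}\dfrac{B_s}{s!}x^s$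 (Bernoulli numbers, $B_1=-1/2$). Define the commutative bilinear product on $\mathbb QZ$: $$ z_{s_1,r_1}\diamond z_{s_2,r_2} :=\binom{r_1+r_2-2}{r_1-1}\biggl(z_{s_1+s_2,r_1+r_2-1} +\sum_{j=1}^{s_1}(-1)^{s_2-1}\binom{s_1+s_2-j-1}{s_1-j}\lambda_{s_1+s_2-j}z_{j,r_1+r_2-1} +\sum_{j=1}^{s_2}(-1)^{s_1-1}\binom{s_1+s_2-j-1}{s_2-j}\lambda_{s_1+s_2-j}z_{j,r_1+r_2-1}\biggr). $$ The stuffle product $\star$ on $\mathbb Q\langle Z\rangle$ is the bilinear product defined recursively by $1\star w=w\star1=w$ and $aw\star bv=a(w\star bv)+b(aw\star v)+(a\diamond b)(w\star v)$ for words $w,v$ and letters $a,b\in Z$. -}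

module Defs where

open import Data.Nat as ℕ using (ℕ; zero; suc; _∸_; _!; _≤ᵇ_; _≡ᵇ_; NonZero)
open import Data.Nat.Properties using (_!≢0)
open import Data.Nat.Combinatorics using (_C_)
open import Data.Integer using (+_)
open import Data.Rational using (ℚ; 0ℚ; 1ℚ; _+_; _*_; -_; _/_)
open import Data.Bool using (if_then_else_)
open import Data.List using (List; []; _∷_; _++_; map; concatMap; upTo)
open import Data.Product using (_×_; _,_)

Σ< : ℕ → (ℕ → ℚ) → ℚ
Σ< zero    f = 0ℚ
Σ< (suc n) f = Σ< n f + f n

Σ1to : ℕ → (ℕ → ℚ) → ℚ
Σ1to n f = Σ< n (λ k → f (suc k))

ℕ→ℚ : ℕ → ℚ
ℕ→ℚ n = + n / 1

invFact : ℕ → ℚ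
invFact m = (+ 1 / m !) {{m !≢0}}

signPow : ℕ → ℚ
signPow zero    = 1ℚ
signPow (suc k) = - signPow k

-- λ_s : Σ_s λ_s x^s = -x/(1-e^x) = x/(e^x - 1)  (B_1 = -1/2).
-- Coefficientwise, x = (e^x - 1) · Σ λ_s x^s, i.e.
--   λ_0 = 1,  λ_{n+1} = - Σ_{k=0}^{n} λ_k / (n+2-k)! .
-- lamUpTo n k is λ_k for k ≤ n.
lamUpTo : ℕ → ℕ → ℚ
lamUpTo zero    k = 1ℚ
lamUpTo (suc n) k =
  if k ≤ᵇ n then lamUpTo n k
  else - Σ< (suc n) (λ i → lamUpTo n i * invFact (suc (suc n) ∸ i))

lam : ℕ → ℚ
lam s = lamUpTo s s

Series : Set
Series = ℕ → ℚ

_·ₛ_ : Series → Series → Series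
(f ·ₛ g) N = Σ< (suc N) (λ k → f k * g (N ∸ k))

-- Bi-brackets.  A bi-bracket [s_1..s_l ; r_1..r_l] is given by the list
-- of pairs (s_j , r_j).  bbAux ps M N = coefficient of q^N in the sum
-- restricted to M > n_1 > ... > n_l > 0, d_j > 0.

bbAux : List (ℕ × ℕ) → ℕ → ℕ → ℚ
bbAux []             M N = if N ≡ᵇ 0 then 1ℚ else 0ℚ
bbAux ((s , r) ∷ ps) M N =
  Σ1to (M ∸ 1) λ n → Σ1to N λ d →
    if n ℕ.* d ≤ᵇ N
    then ((ℕ→ℚ (n ℕ.^ r) * ℕ→ℚ (d ℕ.^ (s ∸ 1)))
            * (invFact r * invFact (s ∸ 1)))
         * bbAux ps n (N ∸ n ℕ.* d)
    else 0ℚ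

-- the q-series of the bi-bracket (n_1 ≤ N automatically since n_1 d_1 ≤ N)
biBracket : List (ℕ × ℕ) → Series
biBracket ps N = bbAux ps (suc N) N

data Letter : Set where
  z : (s r : ℕ) → .{{_ : NonZero s}} → .{{_ : NonZero r}} → Letter

Word : Set
Word = List Letter

Poly : Set
Poly = List (ℚ × Word)

scale : ℚ → Poly → Poly
scale c = map (λ { (a , w) → (c * a , w) })

prepend : Letter → Poly → Poly
prepend a = map (λ { (c , w) → (c , a ∷ w) })

_·ᶜ_ : Poly → Poly → Poly
p ·ᶜ q = concatMap (λ { (c , w) → map (λ { (d , v) → (c * d , w ++ v) }) q }) p

private
  nz+ : ∀ a b → .{{NonZero a}} → NonZero (a ℕ.+ b)
  nz+ (suc a) b = _

  nz+∸1 : ∀ a b → .{{NonZero a}} → .{{NonZero b}} → NonZero (a ℕ.+ b ∸ 1)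
  nz+∸1 (suc a) (suc b) = nz+ (suc b) a
    |> subst NonZero (+-comm (suc b) a)
    where
      open import Relation.Binary.PropositionalEquality using (subst)
      open import Data.Nat.Properties using (+-comm)
      open import Function using (_|>_)

_◇_ : Letter → Letter → Poly
z s₁ r₁ ◇ z s₂ r₂ =
  scale (ℕ→ℚ ((r₁ ℕ.+ r₂ ∸ 2) C (r₁ ∸ 1)))
    ( (1ℚ , z (s₁ ℕ.+ s₂) r {{nz+ s₁ s₂}} {{nzr}} ∷ [])
    ∷ (map (λ i → let j = suc i in
          ( (signPow (s₂ ∸ 1) * ℕ→ℚ ((s₁ ℕ.+ s₂ ∸ j ∸ 1) C (s₁ ∸ j)))
              * lam (s₁ ℕ.+ s₂ ∸ j)
          , z j r {{_}} {{nzr}} ∷ [])) (upTo s₁)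
    ++ map (λ i → let j = suc i in
          ( (signPow (s₁ ∸ 1) * ℕ→ℚ ((s₁ ℕ.+ s₂ ∸ j ∸ 1) C (s₂ ∸ j)))
              * lam (s₁ ℕ.+ s₂ ∸ j)
          , z j r {{_}} {{nzr}} ∷ [])) (upTo s₂)))
  where
    r = r₁ ℕ.+ r₂ ∸ 1
    nzr : NonZero r
    nzr = nz+∸1 r₁ r₂

stuffleW : Word → Word → Poly
stuffleW []      v       = (1ℚ , v) ∷ []
stuffleW (a ∷ w) []      = (1ℚ , a ∷ w) ∷ []
stuffleW (a ∷ w) (b ∷ v) =
     prepend a (stuffleW w (b ∷ v))
  ++ prepend b (stuffleW (a ∷ w) v)
  ++ ((a ◇ b) ·ᶜ stuffleW w v)

_⋆_ : Poly → Poly → Poly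
p ⋆ q = concatMap (λ { (c , w) → concatMap (λ { (d , v) → scale (c * d) (stuffleW w v) }) q }) p

letterIdx : Letter → ℕ × ℕ
letterIdx (z s r) = (s , r ∸ 1)

evalW : Word → Series
evalW w = biBracket (map letterIdx w)

eval : Poly → Series
eval []             N = 0ℚ
eval ((c , w) ∷ p)  N = c * evalW w N + eval p N

module Submission where

-- By bilinearity it suffices to treat words, and for words we prove the
-- stronger statement for bi-brackets truncated to n₁ < M, by induction on
-- the words and on M.  Raising M by one adds the terms with n₁ = M, which
-- factor as a level series Σ_d M^r d^{s-1}/(r!(s-1)!) q^{Md} times a truncated
-- bracket of the remaining letters; the stuffle recursion then reduces the
-- claim to level-product: two level series at the same n multiply by the
-- diamond product.  Both sides are dilations q ↦ qⁿ, and after splitting off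
-- powers of n this is the identity convPow≡convPoly for Σ_{0<d<D} d^a/a! (D-d)^b/b!,
-- proved by induction on a from Faulhaber's formula and the reflection
-- (-1)^k λ_k = λ_k + [k = 1] of the Bernoulli numbers.

open import Defs
open import Data.Nat as ℕ using (ℕ; zero; suc; _∸_; _!; _≤ᵇ_; _≡ᵇ_; NonZero; z≤n; s≤s; _≤_; _<_; _≤?_)
import Data.Nat.Properties as ℕₚ
open import Data.Nat.Combinatorics using (_C_; nCn≡1; nCk+nC[k+1]≡[n+1]C[k+1])
open import Data.Nat.Tactic.RingSolver using (solve-∀)
open import Data.Nat.Divisibility using (_∣_; divides; _∣?_; ∣m∸n∣n⇒∣m)
import Data.Nat.Coprimality as Coprime
import Data.Integer as ℤ
import Data.Integer.Properties as ℤₚ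
open import Data.Rational using (ℚ; 0ℚ; 1ℚ; _+_; _*_; -_; _-_; mkℚ; _/_)
import Data.Rational.Properties as ℚₚ
open import Data.Rational.Solver using (module +-*-Solver)
open import Data.Bool using (true; false; if_then_else_; T)
open import Data.Unit using (tt)
open import Data.Empty using (⊥-elim)
open import Data.List using ([]; _∷_; _++_; map; concatMap; upTo; applyUpTo)
open import Data.Product using (_×_; _,_; proj₁)
open import Data.Sum using (inj₁; inj₂)
open import Relation.Nullary using (¬_; Dec; yes; no)
open import Algebra.Properties.Group ℚₚ.+-0-group using () renaming (∙-cancelˡ to +-cancelˡ)
open import Relation.Binary.PropositionalEquality
open ≡-Reasoning
open +-*-Solver

ℕ→ℚ-suc : ∀ n → ℕ→ℚ (suc n) ≡ 1ℚ + ℕ→ℚ n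
ℕ→ℚ-suc n = trans (ℚₚ./-cong {p₁ = ℤ.+ suc n} {p₂ = ℤ.+ 1 ℤ.* ℤ.+ 1 ℤ.+ ℤ.+ n ℤ.* ℤ.+ 1}
                    (cong (λ k → ℤ.+ 1 ℤ.+ k) (sym (ℤₚ.*-identityʳ (ℤ.+ n)))) refl)
                  (cong (1ℚ +_) (sym (ℚₚ.normalize-coprime (Coprime.sym (Coprime.1-coprimeTo n)))))

ℕ→ℚ-+ : ∀ m n → ℕ→ℚ (m ℕ.+ n) ≡ ℕ→ℚ m + ℕ→ℚ n
ℕ→ℚ-+ zero    n = sym (ℚₚ.+-identityˡ (ℕ→ℚ n))
ℕ→ℚ-+ (suc m) n = begin
  ℕ→ℚ (suc (m ℕ.+ n))     ≡⟨ ℕ→ℚ-suc (m ℕ.+ n) ⟩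
  1ℚ + ℕ→ℚ (m ℕ.+ n)      ≡⟨ cong (1ℚ +_) (ℕ→ℚ-+ m n) ⟩
  1ℚ + (ℕ→ℚ m + ℕ→ℚ n)    ≡⟨ sym (ℚₚ.+-assoc 1ℚ (ℕ→ℚ m) (ℕ→ℚ n)) ⟩
  (1ℚ + ℕ→ℚ m) + ℕ→ℚ n    ≡⟨ cong (_+ ℕ→ℚ n) (sym (ℕ→ℚ-suc m)) ⟩
  ℕ→ℚ (suc m) + ℕ→ℚ n     ∎

ℕ→ℚ-* : ∀ m n → ℕ→ℚ (m ℕ.* n) ≡ ℕ→ℚ m * ℕ→ℚ n
ℕ→ℚ-* zero    n = sym (ℚₚ.*-zeroˡ (ℕ→ℚ n))
ℕ→ℚ-* (suc m) n = begin
  ℕ→ℚ (n ℕ.+ m ℕ.* n)     ≡⟨ ℕ→ℚ-+ n (m ℕ.* n) ⟩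
  ℕ→ℚ n + ℕ→ℚ (m ℕ.* n)   ≡⟨ cong (ℕ→ℚ n +_) (ℕ→ℚ-* m n) ⟩
  ℕ→ℚ n + ℕ→ℚ m * ℕ→ℚ n   ≡⟨ solve 2 (λ a b → b :+ a :* b := (con 1ℚ :+ a) :* b) refl (ℕ→ℚ m) (ℕ→ℚ n) ⟩
  (1ℚ + ℕ→ℚ m) * ℕ→ℚ n    ≡⟨ cong (_* ℕ→ℚ n) (sym (ℕ→ℚ-suc m)) ⟩
  ℕ→ℚ (suc m) * ℕ→ℚ n     ∎

ℕ→ℚ-∸ : ∀ {m n} → n ≤ m → ℕ→ℚ (m ∸ n) + ℕ→ℚ n ≡ ℕ→ℚ m
ℕ→ℚ-∸ {m} {n} n≤m = trans (sym (ℕ→ℚ-+ (m ∸ n) n)) (cong ℕ→ℚ (ℕₚ.m∸n+n≡m n≤m))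

pow : ℚ → ℕ → ℚ
pow x zero    = 1ℚ
pow x (suc k) = x * pow x k

ℕ→ℚ-^ : ∀ m k → ℕ→ℚ (m ℕ.^ k) ≡ pow (ℕ→ℚ m) k
ℕ→ℚ-^ m zero    = refl
ℕ→ℚ-^ m (suc k) = trans (ℕ→ℚ-* m (m ℕ.^ k)) (cong (ℕ→ℚ m *_) (ℕ→ℚ-^ m k))

pow-one : ∀ k → pow 1ℚ k ≡ 1ℚ
pow-one zero    = refl
pow-one (suc k) = cong (1ℚ *_) (pow-one k)

pow-zero : ∀ k → pow 0ℚ (suc k) ≡ 0ℚ
pow-zero k = ℚₚ.*-zeroˡ (pow 0ℚ k)

pow-minus-one : ∀ k → pow (- 1ℚ) k ≡ signPow k
pow-minus-one zero    = refl
pow-minus-one (suc k) =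
  trans (cong ((- 1ℚ) *_) (pow-minus-one k)) (solve 1 (λ s → (:- con 1ℚ) :* s := :- s) refl (signPow k))

signPow-+ : ∀ m n → signPow (m ℕ.+ n) ≡ signPow m * signPow n
signPow-+ zero    n = sym (ℚₚ.*-identityˡ _)
signPow-+ (suc m) n = trans (cong -_ (signPow-+ m n)) (ℚₚ.neg-distribˡ-* (signPow m) (signPow n))

reciprocal-inverse : ∀ n .{{_ : NonZero n}} → (ℤ.+ 1 / n) * ℕ→ℚ n ≡ 1ℚ
reciprocal-inverse (suc k) = begin
  (ℤ.+ 1 / suc k) * ℕ→ℚ (suc k)
    ≡⟨ cong₂ _*_ (ℚₚ.normalize-coprime {1} {k} (Coprime.1-coprimeTo (suc k)))
                 (ℚₚ.normalize-coprime (Coprime.sym (Coprime.1-coprimeTo (suc k)))) ⟩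
  mkℚ (ℤ.+ 1) k (Coprime.1-coprimeTo (suc k)) * mkℚ (ℤ.+ suc k) 0 (Coprime.sym (Coprime.1-coprimeTo (suc k)))
    ≡⟨ ℚₚ.*-inverseˡ (mkℚ (ℤ.+ suc k) 0 (Coprime.sym (Coprime.1-coprimeTo (suc k)))) ⟩
  1ℚ ∎

*-cancelˡ-suc : ∀ n (x y : ℚ) → ℕ→ℚ (suc n) * x ≡ ℕ→ℚ (suc n) * y → x ≡ y
*-cancelˡ-suc n x y eq = begin
  x                                    ≡⟨ sym (ℚₚ.*-identityˡ x) ⟩
  1ℚ * x                               ≡⟨ cong (_* x) (sym (reciprocal-inverse (suc n))) ⟩
  (ℤ.+ 1 / suc n) * ℕ→ℚ (suc n) * x      ≡⟨ ℚₚ.*-assoc (ℤ.+ 1 / suc n) (ℕ→ℚ (suc n)) x ⟩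
  (ℤ.+ 1 / suc n) * (ℕ→ℚ (suc n) * x)    ≡⟨ cong ((ℤ.+ 1 / suc n) *_) eq ⟩
  (ℤ.+ 1 / suc n) * (ℕ→ℚ (suc n) * y)    ≡⟨ sym (ℚₚ.*-assoc (ℤ.+ 1 / suc n) (ℕ→ℚ (suc n)) y) ⟩
  (ℤ.+ 1 / suc n) * ℕ→ℚ (suc n) * y      ≡⟨ cong (_* y) (reciprocal-inverse (suc n)) ⟩
  1ℚ * y                               ≡⟨ ℚₚ.*-identityˡ y ⟩
  y                                    ∎

invFact-! : ∀ n → invFact n * ℕ→ℚ (n !) ≡ 1ℚ
invFact-! n = reciprocal-inverse (n !) {{n ℕₚ.!≢0}}

invFact-suc : ∀ n → invFact (suc n) * ℕ→ℚ (suc n) ≡ invFact n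
invFact-suc n = sym (begin
  invFact n
    ≡⟨ sym (ℚₚ.*-identityʳ _) ⟩
  invFact n * 1ℚ
    ≡⟨ cong (invFact n *_) (sym (invFact-! (suc n))) ⟩
  invFact n * (invFact (suc n) * ℕ→ℚ (suc n !))
    ≡⟨ cong (λ x → invFact n * (invFact (suc n) * x)) (ℕ→ℚ-* (suc n) (n !)) ⟩
  invFact n * (invFact (suc n) * (ℕ→ℚ (suc n) * ℕ→ℚ (n !)))
    ≡⟨ solve 4 (λ a s b f → b :* (a :* (s :* f)) := a :* s :* (b :* f)) refl
         (invFact (suc n)) (ℕ→ℚ (suc n)) (invFact n) (ℕ→ℚ (n !)) ⟩
  invFact (suc n) * ℕ→ℚ (suc n) * (invFact n * ℕ→ℚ (n !))
    ≡⟨ cong (invFact (suc n) * ℕ→ℚ (suc n) *_) (invFact-! n) ⟩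
  invFact (suc n) * ℕ→ℚ (suc n) * 1ℚ
    ≡⟨ ℚₚ.*-identityʳ _ ⟩
  invFact (suc n) * ℕ→ℚ (suc n) ∎)

choose-factorials : ∀ x y → ((x ℕ.+ y) C x) ℕ.* (x ! ℕ.* y !) ≡ (x ℕ.+ y) !
choose-factorials zero    y = trans (ℕₚ.*-identityˡ (1 ℕ.* y !)) (ℕₚ.*-identityˡ (y !))
choose-factorials (suc x) zero = begin
  ((suc x ℕ.+ 0) C suc x) ℕ.* (suc x ! ℕ.* 1)
    ≡⟨ cong (λ n → (n C suc x) ℕ.* (suc x ! ℕ.* 1)) (ℕₚ.+-identityʳ (suc x)) ⟩
  (suc x C suc x) ℕ.* (suc x ! ℕ.* 1)
    ≡⟨ cong (ℕ._* (suc x ! ℕ.* 1)) (nCn≡1 (suc x)) ⟩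
  1 ℕ.* (suc x ! ℕ.* 1)
    ≡⟨ trans (ℕₚ.*-identityˡ (suc x ! ℕ.* 1)) (ℕₚ.*-identityʳ (suc x !)) ⟩
  suc x !
    ≡⟨ cong _! (sym (ℕₚ.+-identityʳ (suc x))) ⟩
  (suc x ℕ.+ 0) ! ∎
choose-factorials (suc x) (suc y) = begin
  (suc (x ℕ.+ suc y) C suc x) ℕ.* (suc x ! ℕ.* suc y !)
    ≡⟨ cong (ℕ._* (suc x ! ℕ.* suc y !)) (sym (nCk+nC[k+1]≡[n+1]C[k+1] (x ℕ.+ suc y) x)) ⟩
  ((x ℕ.+ suc y) C x ℕ.+ (x ℕ.+ suc y) C suc x) ℕ.* (suc x ! ℕ.* suc y !)
    ≡⟨ cong (λ n → ((x ℕ.+ suc y) C x ℕ.+ n C suc x) ℕ.* (suc x ! ℕ.* suc y !)) (ℕₚ.+-suc x y) ⟩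
  (A ℕ.+ B) ℕ.* (suc x ! ℕ.* suc y !)
    ≡⟨ distribute A B x y (x !) (y !) ⟩
  suc x ℕ.* (A ℕ.* (x ! ℕ.* suc y !)) ℕ.+ suc y ℕ.* (B ℕ.* (suc x ! ℕ.* y !))
    ≡⟨ cong₂ (λ u v → suc x ℕ.* u ℕ.+ suc y ℕ.* v) (choose-factorials x (suc y)) (choose-factorials (suc x) y) ⟩
  suc x ℕ.* (x ℕ.+ suc y) ! ℕ.+ suc y ℕ.* (suc x ℕ.+ y) !
    ≡⟨ cong (λ n → suc x ℕ.* (x ℕ.+ suc y) ! ℕ.+ suc y ℕ.* n !) (sym (ℕₚ.+-suc x y)) ⟩
  suc x ℕ.* (x ℕ.+ suc y) ! ℕ.+ suc y ℕ.* (x ℕ.+ suc y) !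
    ≡⟨ sym (ℕₚ.*-distribʳ-+ ((x ℕ.+ suc y) !) (suc x) (suc y)) ⟩
  suc (x ℕ.+ suc y) ! ∎
  where
  A = (x ℕ.+ suc y) C x
  B = (suc x ℕ.+ y) C suc x
  distribute : ∀ A B x y fx fy → (A ℕ.+ B) ℕ.* ((suc x ℕ.* fx) ℕ.* (suc y ℕ.* fy))
    ≡ suc x ℕ.* (A ℕ.* (fx ℕ.* (suc y ℕ.* fy))) ℕ.+ suc y ℕ.* (B ℕ.* ((suc x ℕ.* fx) ℕ.* fy))
  distribute = solve-∀

multinomial : ℕ → ℕ → ℚ
multinomial u v = ℕ→ℚ ((u ℕ.+ v) !) * invFact u * invFact v

choose≡multinomial : ∀ u v → ℕ→ℚ ((u ℕ.+ v) C u) ≡ multinomial u v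
choose≡multinomial u v = begin
  c ≡⟨ solve 1 (λ c → c := c :* con 1ℚ :* con 1ℚ) refl c ⟩
  c * 1ℚ * 1ℚ ≡⟨ cong₂ (λ s t → c * s * t) (sym (invFact-! u)) (sym (invFact-! v)) ⟩
  c * (invFact u * ℕ→ℚ (u !)) * (invFact v * ℕ→ℚ (v !))
    ≡⟨ solve 5 (λ c i f j g → c :* (i :* f) :* (j :* g) := c :* (f :* g) :* i :* j) refl
         c (invFact u) (ℕ→ℚ (u !)) (invFact v) (ℕ→ℚ (v !)) ⟩
  c * (ℕ→ℚ (u !) * ℕ→ℚ (v !)) * invFact u * invFact v
    ≡⟨ cong (λ t → t * invFact u * invFact v)
         (trans (cong (c *_) (sym (ℕ→ℚ-* (u !) (v !)))) (sym (ℕ→ℚ-* ((u ℕ.+ v) C u) (u ! ℕ.* v !)))) ⟩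
  ℕ→ℚ (((u ℕ.+ v) C u) ℕ.* (u ! ℕ.* v !)) * invFact u * invFact v
    ≡⟨ cong (λ n → ℕ→ℚ n * invFact u * invFact v) (choose-factorials u v) ⟩
  multinomial u v ∎
  where c = ℕ→ℚ ((u ℕ.+ v) C u)

Σ-cong : ∀ n {f g : ℕ → ℚ} → (∀ k → k < n → f k ≡ g k) → Σ< n f ≡ Σ< n g
Σ-cong zero    h = refl
Σ-cong (suc n) h = cong₂ _+_ (Σ-cong n (λ k k<n → h k (ℕₚ.m<n⇒m<1+n k<n))) (h n ℕₚ.≤-refl)

Σ-ext : ∀ n {f g : ℕ → ℚ} → (∀ k → f k ≡ g k) → Σ< n f ≡ Σ< n g
Σ-ext n h = Σ-cong n (λ k _ → h k)

Σ-+ : ∀ n (f g : ℕ → ℚ) → Σ< n (λ k → f k + g k) ≡ Σ< n f + Σ< n g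
Σ-+ zero    f g = sym (ℚₚ.+-identityˡ 0ℚ)
Σ-+ (suc n) f g = begin
  Σ< n (λ k → f k + g k) + (f n + g n) ≡⟨ cong (_+ (f n + g n)) (Σ-+ n f g) ⟩
  Σ< n f + Σ< n g + (f n + g n)
    ≡⟨ solve 4 (λ a b c d → a :+ b :+ (c :+ d) := a :+ c :+ (b :+ d)) refl (Σ< n f) (Σ< n g) (f n) (g n) ⟩
  Σ< n f + f n + (Σ< n g + g n) ∎

Σ-*ˡ : ∀ n (c : ℚ) (f : ℕ → ℚ) → Σ< n (λ k → c * f k) ≡ c * Σ< n f
Σ-*ˡ zero    c f = sym (ℚₚ.*-zeroʳ c)
Σ-*ˡ (suc n) c f = trans (cong (_+ c * f n) (Σ-*ˡ n c f)) (sym (ℚₚ.*-distribˡ-+ c (Σ< n f) (f n)))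

Σ-*ʳ : ∀ n (c : ℚ) (f : ℕ → ℚ) → Σ< n (λ k → f k * c) ≡ Σ< n f * c
Σ-*ʳ n c f = trans (Σ-ext n (λ k → ℚₚ.*-comm (f k) c)) (trans (Σ-*ˡ n c f) (ℚₚ.*-comm c _))

Σ-neg : ∀ n (f : ℕ → ℚ) → Σ< n (λ k → - f k) ≡ - Σ< n f
Σ-neg zero    f = refl
Σ-neg (suc n) f = trans (cong (_+ - f n) (Σ-neg n f)) (sym (ℚₚ.neg-distrib-+ (Σ< n f) (f n)))

Σ-zero : ∀ n {f : ℕ → ℚ} → (∀ k → k < n → f k ≡ 0ℚ) → Σ< n f ≡ 0ℚ
Σ-zero n {f} h = trans (Σ-cong n h) (Σ-const-zero n)
  where
  Σ-const-zero : ∀ n → Σ< n (λ _ → 0ℚ) ≡ 0ℚ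
  Σ-const-zero zero    = refl
  Σ-const-zero (suc n) = trans (cong (_+ 0ℚ) (Σ-const-zero n)) (ℚₚ.+-identityʳ 0ℚ)

Σ-head : ∀ n (f : ℕ → ℚ) → Σ< (suc n) f ≡ f 0 + Σ< n (λ k → f (suc k))
Σ-head zero    f = trans (ℚₚ.+-identityˡ (f 0)) (sym (ℚₚ.+-identityʳ (f 0)))
Σ-head (suc n) f = begin
  Σ< (suc n) f + f (suc n)                   ≡⟨ cong (_+ f (suc n)) (Σ-head n f) ⟩
  f 0 + Σ< n (λ k → f (suc k)) + f (suc n)   ≡⟨ ℚₚ.+-assoc (f 0) _ _ ⟩
  f 0 + (Σ< n (λ k → f (suc k)) + f (suc n)) ∎

Σ-swap : ∀ n m (f : ℕ → ℕ → ℚ) → Σ< n (λ i → Σ< m (λ j → f i j)) ≡ Σ< m (λ j → Σ< n (λ i → f i j))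
Σ-swap zero    m f = sym (Σ-zero m (λ _ _ → refl))
Σ-swap (suc n) m f = begin
  Σ< n (λ i → Σ< m (λ j → f i j)) + Σ< m (λ j → f n j)
    ≡⟨ cong (_+ Σ< m (λ j → f n j)) (Σ-swap n m f) ⟩
  Σ< m (λ j → Σ< n (λ i → f i j)) + Σ< m (λ j → f n j)
    ≡⟨ sym (Σ-+ m (λ j → Σ< n (λ i → f i j)) (λ j → f n j)) ⟩
  Σ< m (λ j → Σ< n (λ i → f i j) + f n j) ∎

Σ-split : ∀ m n (f : ℕ → ℚ) → Σ< (m ℕ.+ n) f ≡ Σ< m f + Σ< n (λ k → f (m ℕ.+ k))
Σ-split m zero    f = trans (cong (λ x → Σ< x f) (ℕₚ.+-identityʳ m)) (sym (ℚₚ.+-identityʳ _))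
Σ-split m (suc n) f = begin
  Σ< (m ℕ.+ suc n) f                               ≡⟨ cong (λ x → Σ< x f) (ℕₚ.+-suc m n) ⟩
  Σ< (m ℕ.+ n) f + f (m ℕ.+ n)                     ≡⟨ cong (_+ f (m ℕ.+ n)) (Σ-split m n f) ⟩
  Σ< m f + Σ< n (λ k → f (m ℕ.+ k)) + f (m ℕ.+ n)  ≡⟨ ℚₚ.+-assoc (Σ< m f) _ _ ⟩
  Σ< m f + (Σ< n (λ k → f (m ℕ.+ k)) + f (m ℕ.+ n)) ∎

Σ-extend : ∀ n n' {f : ℕ → ℚ} → n ≤ n' → (∀ k → n ≤ k → k < n' → f k ≡ 0ℚ) → Σ< n' f ≡ Σ< n f
Σ-extend n n' {f} n≤n' h = begin
  Σ< n' f                                  ≡⟨ cong (λ x → Σ< x f) (sym (ℕₚ.m+[n∸m]≡n n≤n')) ⟩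
  Σ< (n ℕ.+ (n' ∸ n)) f                    ≡⟨ Σ-split n (n' ∸ n) f ⟩
  Σ< n f + Σ< (n' ∸ n) (λ k → f (n ℕ.+ k)) ≡⟨ cong (Σ< n f +_) (Σ-zero (n' ∸ n) tail-vanishes) ⟩
  Σ< n f + 0ℚ                              ≡⟨ ℚₚ.+-identityʳ _ ⟩
  Σ< n f                                   ∎
  where
  tail-vanishes : ∀ k → k < n' ∸ n → f (n ℕ.+ k) ≡ 0ℚ
  tail-vanishes k k< = h (n ℕ.+ k) (ℕₚ.m≤m+n n k)
    (subst (λ x → n ℕ.+ k < x) (ℕₚ.m+[n∸m]≡n n≤n') (ℕₚ.+-monoʳ-< n k<))

Σ-single : ∀ n t {f : ℕ → ℚ} → t < n → (∀ k → k < n → ¬ k ≡ t → f k ≡ 0ℚ) → Σ< n f ≡ f t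
Σ-single n t {f} t<n h = begin
  Σ< n f       ≡⟨ Σ-extend (suc t) n t<n (λ k t<k k<n → h k k<n λ { refl → ℕₚ.<-irrefl refl t<k }) ⟩
  Σ< t f + f t ≡⟨ cong (_+ f t) (Σ-zero t (λ k k<t → h k (ℕₚ.<-trans k<t t<n) λ { refl → ℕₚ.<-irrefl refl k<t })) ⟩
  0ℚ + f t     ≡⟨ ℚₚ.+-identityˡ (f t) ⟩
  f t          ∎

Σ-reverse : ∀ n (f : ℕ → ℚ) → Σ< n f ≡ Σ< n (λ k → f (n ∸ suc k))
Σ-reverse zero    f = refl
Σ-reverse (suc n) f = begin
  Σ< n f + f n                       ≡⟨ cong (_+ f n) (Σ-reverse n f) ⟩
  Σ< n (λ k → f (n ∸ suc k)) + f n   ≡⟨ ℚₚ.+-comm _ (f n) ⟩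
  f n + Σ< n (λ k → f (n ∸ suc k))   ≡⟨ sym (Σ-head n (λ k → f (suc n ∸ suc k))) ⟩
  Σ< (suc n) (λ k → f (suc n ∸ suc k)) ∎

Σ-triangle : ∀ N (F : ℕ → ℕ → ℚ) →
  Σ< (suc N) (λ k → Σ< (suc k) (λ i → F i k)) ≡ Σ< (suc N) (λ i → Σ< (suc (N ∸ i)) (λ j → F i (i ℕ.+ j)))
Σ-triangle zero    F = refl
Σ-triangle (suc N) F = begin
  Σ< (suc N) (λ k → Σ< (suc k) (λ i → F i k)) + Σ< (suc (suc N)) (λ i → F i (suc N))
    ≡⟨ cong (_+ Σ< (suc (suc N)) (λ i → F i (suc N))) (Σ-triangle N F) ⟩
  R + (Σ< (suc N) (λ i → F i (suc N)) + F (suc N) (suc N))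
    ≡⟨ sym (ℚₚ.+-assoc R _ _) ⟩
  R + Σ< (suc N) (λ i → F i (suc N)) + F (suc N) (suc N)
    ≡⟨ cong₂ _+_ (sym (Σ-+ (suc N) _ _)) (cong (F (suc N)) (sym (ℕₚ.+-identityʳ (suc N)))) ⟩
  Σ< (suc N) (λ i → Σ< (suc (N ∸ i)) (λ j → F i (i ℕ.+ j)) + F i (suc N)) + F (suc N) (suc N ℕ.+ 0)
    ≡⟨ cong (_+ F (suc N) (suc N ℕ.+ 0)) (Σ-cong (suc N) extend-row) ⟩
  Σ< (suc N) (λ i → Σ< (suc (suc N ∸ i)) (λ j → F i (i ℕ.+ j))) + F (suc N) (suc N ℕ.+ 0)
    ≡⟨ cong (Σ< (suc N) (λ i → Σ< (suc (suc N ∸ i)) (λ j → F i (i ℕ.+ j))) +_)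
         (trans (sym (ℚₚ.+-identityˡ _)) (cong (λ y → Σ< (suc y) (λ j → F (suc N) (suc N ℕ.+ j))) (sym (ℕₚ.n∸n≡0 N)))) ⟩
  Σ< (suc (suc N)) (λ i → Σ< (suc (suc N ∸ i)) (λ j → F i (i ℕ.+ j))) ∎
  where
  R : ℚ
  R = Σ< (suc N) (λ i → Σ< (suc (N ∸ i)) (λ j → F i (i ℕ.+ j)))
  extend-row : ∀ i → i < suc N →
    Σ< (suc (N ∸ i)) (λ j → F i (i ℕ.+ j)) + F i (suc N) ≡ Σ< (suc (suc N ∸ i)) (λ j → F i (i ℕ.+ j))
  extend-row i (s≤s i≤N) = begin
    Σ< (suc (N ∸ i)) (λ j → F i (i ℕ.+ j)) + F i (suc N)
      ≡⟨ cong (λ x → Σ< (suc (N ∸ i)) (λ j → F i (i ℕ.+ j)) + F i x)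
           (trans (cong suc (sym (ℕₚ.m+[n∸m]≡n i≤N))) (sym (ℕₚ.+-suc i (N ∸ i)))) ⟩
    Σ< (suc (suc (N ∸ i))) (λ j → F i (i ℕ.+ j))
      ≡⟨ cong (λ x → Σ< (suc x) (λ j → F i (i ℕ.+ j))) (sym (ℕₚ.+-∸-assoc 1 i≤N)) ⟩
    Σ< (suc (suc N ∸ i)) (λ j → F i (i ℕ.+ j)) ∎

Σ-triangle′ : ∀ b (G : ℕ → ℕ → ℚ) →
  Σ< (suc b) (λ k → Σ< (suc (b ∸ k)) (λ i → G k i)) ≡ Σ< (suc b) (λ i → Σ< (suc (b ∸ i)) (λ k → G k i))
Σ-triangle′ b G = begin
  Σ< (suc b) (λ k → Σ< (suc (b ∸ k)) (λ i → G k i))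
    ≡⟨ Σ-ext (suc b) (λ k → Σ-ext (suc (b ∸ k)) (λ j → cong (G k) (sym (ℕₚ.m+n∸m≡n k j)))) ⟩
  Σ< (suc b) (λ k → Σ< (suc (b ∸ k)) (λ j → G k (k ℕ.+ j ∸ k)))
    ≡⟨ sym (Σ-triangle b (λ k K → G k (K ∸ k))) ⟩
  Σ< (suc b) (λ K → Σ< (suc K) (λ k → G k (K ∸ k)))
    ≡⟨ Σ-ext (suc b) (λ K → trans (Σ-reverse (suc K) _)
         (Σ-cong (suc K) (λ i i< → cong (G (K ∸ i)) (ℕₚ.m∸[m∸n]≡n (ℕₚ.≤-pred i<))))) ⟩
  Σ< (suc b) (λ K → Σ< (suc K) (λ i → G (K ∸ i) i))
    ≡⟨ Σ-triangle b (λ i K → G (K ∸ i) i) ⟩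
  Σ< (suc b) (λ i → Σ< (suc (b ∸ i)) (λ j → G (i ℕ.+ j ∸ i) i))
    ≡⟨ Σ-ext (suc b) (λ i → Σ-ext (suc (b ∸ i)) (λ j → cong (λ t → G t i) (ℕₚ.m+n∸m≡n i j))) ⟩
  Σ< (suc b) (λ i → Σ< (suc (b ∸ i)) (λ k → G k i)) ∎

·-congᵇ : ∀ N {f f' g g' : Series} → (∀ k → k ≤ N → f k ≡ f' k) → (∀ k → k ≤ N → g k ≡ g' k) →
          (f ·ₛ g) N ≡ (f' ·ₛ g') N
·-congᵇ N hf hg = Σ-cong (suc N) (λ k k≤N → cong₂ _*_ (hf k (ℕₚ.≤-pred k≤N)) (hg (N ∸ k) (ℕₚ.m∸n≤m N k)))

·-cong : ∀ N {f f' g g' : Series} → (∀ k → f k ≡ f' k) → (∀ k → g k ≡ g' k) → (f ·ₛ g) N ≡ (f' ·ₛ g') N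
·-cong N hf hg = ·-congᵇ N (λ k _ → hf k) (λ k _ → hg k)

·-congˡ : ∀ N {f f' : Series} (g : Series) → (∀ k → f k ≡ f' k) → (f ·ₛ g) N ≡ (f' ·ₛ g) N
·-congˡ N {f} {f'} g h = ·-cong N {f} {f'} {g} {g} h (λ _ → refl)

·-congʳ : ∀ N (f : Series) {g g' : Series} → (∀ k → g k ≡ g' k) → (f ·ₛ g) N ≡ (f ·ₛ g') N
·-congʳ N f {g} {g'} h = ·-cong N {f} {f} {g} {g'} (λ _ → refl) h

·-comm : ∀ N (f g : Series) → (f ·ₛ g) N ≡ (g ·ₛ f) N
·-comm N f g = begin
  Σ< (suc N) (λ k → f k * g (N ∸ k))             ≡⟨ Σ-reverse (suc N) _ ⟩
  Σ< (suc N) (λ k → f (N ∸ k) * g (N ∸ (N ∸ k))) ≡⟨ Σ-cong (suc N) swap-factors ⟩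
  Σ< (suc N) (λ k → g k * f (N ∸ k))             ∎
  where
  swap-factors : ∀ k → k < suc N → f (N ∸ k) * g (N ∸ (N ∸ k)) ≡ g k * f (N ∸ k)
  swap-factors k k≤N =
    trans (cong (λ x → f (N ∸ k) * g x) (ℕₚ.m∸[m∸n]≡n (ℕₚ.≤-pred k≤N))) (ℚₚ.*-comm (f (N ∸ k)) (g k))

·-+ˡ : ∀ N (f g h : Series) → ((λ n → f n + g n) ·ₛ h) N ≡ (f ·ₛ h) N + (g ·ₛ h) N
·-+ˡ N f g h = trans (Σ-ext (suc N) (λ k → ℚₚ.*-distribʳ-+ (h (N ∸ k)) (f k) (g k))) (Σ-+ (suc N) _ _)

·-+ʳ : ∀ N (f g h : Series) → (h ·ₛ (λ n → f n + g n)) N ≡ (h ·ₛ f) N + (h ·ₛ g) N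
·-+ʳ N f g h = trans (Σ-ext (suc N) (λ k → ℚₚ.*-distribˡ-+ (h k) (f (N ∸ k)) (g (N ∸ k)))) (Σ-+ (suc N) _ _)

·-*ˡ : ∀ N (c : ℚ) (f h : Series) → ((λ n → c * f n) ·ₛ h) N ≡ c * (f ·ₛ h) N
·-*ˡ N c f h = trans (Σ-ext (suc N) (λ k → ℚₚ.*-assoc c (f k) (h (N ∸ k)))) (Σ-*ˡ (suc N) c _)

·-*ʳ : ∀ N (c : ℚ) (f h : Series) → (h ·ₛ (λ n → c * f n)) N ≡ c * (h ·ₛ f) N
·-*ʳ N c f h = trans (Σ-ext (suc N) (λ k → solve 3 (λ a b d → a :* (b :* d) := b :* (a :* d)) refl (h k) c (f (N ∸ k))))
                     (Σ-*ˡ (suc N) c _)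

·-zeroˡ : ∀ N (f h : Series) → (∀ k → f k ≡ 0ℚ) → (f ·ₛ h) N ≡ 0ℚ
·-zeroˡ N f h f≡0 = Σ-zero (suc N) (λ k _ → trans (cong (_* h (N ∸ k)) (f≡0 k)) (ℚₚ.*-zeroˡ (h (N ∸ k))))

·-zeroʳ : ∀ N (f h : Series) → (∀ k → h k ≡ 0ℚ) → (f ·ₛ h) N ≡ 0ℚ
·-zeroʳ N f h h≡0 = trans (·-comm N f h) (·-zeroˡ N h f h≡0)

δ : Series
δ n = if n ≡ᵇ 0 then 1ℚ else 0ℚ

·-unitˡ : ∀ N (f : Series) → (δ ·ₛ f) N ≡ f N
·-unitˡ N f = trans (Σ-head N _) (trans (cong₂ _+_ (ℚₚ.*-identityˡ (f N))
                  (Σ-zero N (λ k _ → ℚₚ.*-zeroˡ (f (N ∸ suc k))))) (ℚₚ.+-identityʳ _))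

·-unitʳ : ∀ N (f : Series) → (f ·ₛ δ) N ≡ f N
·-unitʳ N f = trans (·-comm N f δ) (·-unitˡ N f)

·-assoc : ∀ N (f g h : Series) → ((f ·ₛ g) ·ₛ h) N ≡ (f ·ₛ (g ·ₛ h)) N
·-assoc N f g h = begin
  Σ< (suc N) (λ k → Σ< (suc k) (λ i → f i * g (k ∸ i)) * h (N ∸ k))
    ≡⟨ Σ-ext (suc N) (λ k → sym (Σ-*ʳ (suc k) (h (N ∸ k)) _)) ⟩
  Σ< (suc N) (λ k → Σ< (suc k) (λ i → f i * g (k ∸ i) * h (N ∸ k)))
    ≡⟨ Σ-triangle N (λ i k → f i * g (k ∸ i) * h (N ∸ k)) ⟩
  Σ< (suc N) (λ i → Σ< (suc (N ∸ i)) (λ j → f i * g (i ℕ.+ j ∸ i) * h (N ∸ (i ℕ.+ j))))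
    ≡⟨ Σ-ext (suc N) (λ i → Σ-ext (suc (N ∸ i)) (λ j →
         trans (cong₂ (λ x y → f i * g x * h y) (ℕₚ.m+n∸m≡n i j) (sym (ℕₚ.∸-+-assoc N i j)))
               (ℚₚ.*-assoc (f i) _ _))) ⟩
  Σ< (suc N) (λ i → Σ< (suc (N ∸ i)) (λ j → f i * (g j * h (N ∸ i ∸ j))))
    ≡⟨ Σ-ext (suc N) (λ i → Σ-*ˡ (suc (N ∸ i)) (f i) _) ⟩
  Σ< (suc N) (λ i → f i * Σ< (suc (N ∸ i)) (λ j → g j * h (N ∸ i ∸ j))) ∎

T→≡true : ∀ {b} → T b → b ≡ true
T→≡true {true} _ = refl

¬T→≡false : ∀ {b} → ¬ T b → b ≡ false
¬T→≡false {false} _   = refl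
¬T→≡false {true}  ¬tt = ⊥-elim (¬tt tt)

≡ᵇ-true : ∀ {m n} → m ≡ n → (m ≡ᵇ n) ≡ true
≡ᵇ-true {m} {n} eq = T→≡true (ℕₚ.≡⇒≡ᵇ m n eq)

≡ᵇ-false : ∀ {m n} → ¬ m ≡ n → (m ≡ᵇ n) ≡ false
≡ᵇ-false {m} {n} neq = ¬T→≡false (λ t → neq (ℕₚ.≡ᵇ⇒≡ m n t))

≤ᵇ-true : ∀ {m n} → m ≤ n → (m ≤ᵇ n) ≡ true
≤ᵇ-true m≤n = T→≡true (ℕₚ.≤⇒≤ᵇ m≤n)

≤ᵇ-false : ∀ {m n} → ¬ m ≤ n → (m ≤ᵇ n) ≡ false
≤ᵇ-false {m} {n} m≰n = ¬T→≡false (λ t → m≰n (ℕₚ.≤ᵇ⇒≤ m n t))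

if-true : ∀ {b} {x y : ℚ} → b ≡ true → (if b then x else y) ≡ x
if-true refl = refl

if-false : ∀ {b} {x y : ℚ} → b ≡ false → (if b then x else y) ≡ y
if-false refl = refl

if-* : ∀ b (x y : ℚ) → (if b then x else 0ℚ) * y ≡ (if b then x * y else 0ℚ)
if-* true  x y = refl
if-* false x y = ℚₚ.*-zeroˡ y

if-+ : ∀ b (x y : ℚ) → (if b then x + y else 0ℚ) ≡ (if b then x else 0ℚ) + (if b then y else 0ℚ)
if-+ true  x y = refl
if-+ false x y = sym (ℚₚ.+-identityˡ 0ℚ)

if-c* : ∀ b (c x : ℚ) → (if b then c * x else 0ℚ) ≡ c * (if b then x else 0ℚ)
if-c* true  c x = refl
if-c* false c x = sym (ℚₚ.*-zeroʳ c)

Σ-pick : ∀ N t (F : ℕ → ℚ) → Σ< (suc N) (λ k → if t ≡ᵇ k then F k else 0ℚ) ≡ (if t ≤ᵇ N then F t else 0ℚ)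
Σ-pick N t F with t ≤? N
... | yes t≤N = begin
  Σ< (suc N) (λ k → if t ≡ᵇ k then F k else 0ℚ)
    ≡⟨ Σ-single (suc N) t (s≤s t≤N) (λ k _ k≢t → if-false (≡ᵇ-false (λ e → k≢t (sym e)))) ⟩
  (if t ≡ᵇ t then F t else 0ℚ) ≡⟨ if-true (≡ᵇ-true {t} refl) ⟩
  F t                          ≡⟨ sym (if-true (≤ᵇ-true t≤N)) ⟩
  (if t ≤ᵇ N then F t else 0ℚ) ∎
... | no t≰N = trans (Σ-zero (suc N) (λ k k≤N → if-false (≡ᵇ-false (λ e → t≰N (subst (_≤ N) (sym e) (ℕₚ.≤-pred k≤N))))))
                     (sym (if-false (≤ᵇ-false t≰N)))

eval-++ : ∀ p q N → eval (p ++ q) N ≡ eval p N + eval q N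
eval-++ []            q N = sym (ℚₚ.+-identityˡ _)
eval-++ ((c , w) ∷ p) q N =
  trans (cong (c * evalW w N +_) (eval-++ p q N)) (sym (ℚₚ.+-assoc (c * evalW w N) (eval p N) (eval q N)))

eval-scale : ∀ c p N → eval (scale c p) N ≡ c * eval p N
eval-scale c []            N = sym (ℚₚ.*-zeroʳ c)
eval-scale c ((a , w) ∷ p) N =
  trans (cong (c * a * evalW w N +_) (eval-scale c p N))
        (solve 4 (λ c a b e → c :* a :* b :+ c :* e := c :* (a :* b :+ e)) refl c a (evalW w N) (eval p N))

module _ (multiplicative-on-words : ∀ w v N → eval (stuffleW w v) N ≡ (evalW w ·ₛ evalW v) N) where

  private
    star-word : ∀ c w (K : ℚ × Word → Poly) → (∀ d v → K (d , v) ≡ scale (c * d) (stuffleW w v)) →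
                ∀ q N → eval (concatMap K q) N ≡ c * (evalW w ·ₛ eval q) N
    star-word c w K K≡ [] N =
      sym (trans (cong (c *_) (·-zeroʳ N (evalW w) (eval []) (λ _ → refl))) (ℚₚ.*-zeroʳ c))
    star-word c w K K≡ ((d , v) ∷ q) N = begin
      eval (K (d , v) ++ concatMap K q) N
        ≡⟨ eval-++ (K (d , v)) (concatMap K q) N ⟩
      eval (K (d , v)) N + eval (concatMap K q) N
        ≡⟨ cong₂ _+_ (trans (cong (λ l → eval l N) (K≡ d v))
                       (trans (eval-scale (c * d) (stuffleW w v) N) (cong (c * d *_) (multiplicative-on-words w v N))))
                     (star-word c w K K≡ q N) ⟩
      c * d * (evalW w ·ₛ evalW v) N + c * (evalW w ·ₛ eval q) N
        ≡⟨ solve 4 (λ c d x y → c :* d :* x :+ c :* y := c :* (d :* x :+ y)) refl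
             c d ((evalW w ·ₛ evalW v) N) ((evalW w ·ₛ eval q) N) ⟩
      c * (d * (evalW w ·ₛ evalW v) N + (evalW w ·ₛ eval q) N)
        ≡⟨ cong (c *_) (sym (trans (·-+ʳ N (λ n → d * evalW v n) (eval q) (evalW w))
                                   (cong (_+ (evalW w ·ₛ eval q) N) (·-*ʳ N d (evalW v) (evalW w))))) ⟩
      c * (evalW w ·ₛ eval ((d , v) ∷ q)) N ∎

  multiplicative-on-polynomials : ∀ p q N → eval (p ⋆ q) N ≡ (eval p ·ₛ eval q) N
  multiplicative-on-polynomials [] q N = sym (·-zeroˡ N (eval []) (eval q) (λ _ → refl))
  multiplicative-on-polynomials ((c , w) ∷ p) q N = begin
    eval (concatMap _ q ++ (p ⋆ q)) N
      ≡⟨ eval-++ (concatMap _ q) (p ⋆ q) N ⟩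
    eval (concatMap _ q) N + eval (p ⋆ q) N
      ≡⟨ cong₂ _+_ (star-word c w _ (λ d v → refl) q N) (multiplicative-on-polynomials p q N) ⟩
    c * (evalW w ·ₛ eval q) N + (eval p ·ₛ eval q) N
      ≡⟨ sym (trans (·-+ˡ N (λ n → c * evalW w n) (eval p) (eval q))
                    (cong (_+ (eval p ·ₛ eval q) N) (·-*ˡ N c (evalW w) (eval q)))) ⟩
    (eval ((c , w) ∷ p) ·ₛ eval q) N ∎

dilate : ℕ → (ℕ → ℚ) → Series
dilate n g K = Σ1to K (λ d → if n ℕ.* d ≡ᵇ K then g d else 0ℚ)

-- The pattern in the definition of bbAux is a product with a dilated series.
dilate-convolution : ∀ n' (g : ℕ → ℚ) (X : Series) N →
  Σ1to N (λ d → if suc n' ℕ.* d ≤ᵇ N then g d * X (N ∸ suc n' ℕ.* d) else 0ℚ) ≡ (dilate (suc n') g ·ₛ X) N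
dilate-convolution n' g X N = sym (begin
  Σ< (suc N) (λ k → dilate n g k * X (N ∸ k))
    ≡⟨ Σ-cong (suc N) expand ⟩
  Σ< (suc N) (λ k → Σ< N (λ d' → if n ℕ.* suc d' ≡ᵇ k then g (suc d') * X (N ∸ k) else 0ℚ))
    ≡⟨ Σ-swap (suc N) N _ ⟩
  Σ< N (λ d' → Σ< (suc N) (λ k → if n ℕ.* suc d' ≡ᵇ k then g (suc d') * X (N ∸ k) else 0ℚ))
    ≡⟨ Σ-ext N (λ d' → Σ-pick N (n ℕ.* suc d') (λ k → g (suc d') * X (N ∸ k))) ⟩
  Σ< N (λ d' → if n ℕ.* suc d' ≤ᵇ N then g (suc d') * X (N ∸ n ℕ.* suc d') else 0ℚ) ∎)
  where
  n = suc n'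
  expand : ∀ k → k < suc N → dilate n g k * X (N ∸ k) ≡
           Σ< N (λ d' → if n ℕ.* suc d' ≡ᵇ k then g (suc d') * X (N ∸ k) else 0ℚ)
  expand k k≤N = begin
    Σ< k (λ d' → if n ℕ.* suc d' ≡ᵇ k then g (suc d') else 0ℚ) * X (N ∸ k)
      ≡⟨ sym (Σ-*ʳ k (X (N ∸ k)) _) ⟩
    Σ< k (λ d' → (if n ℕ.* suc d' ≡ᵇ k then g (suc d') else 0ℚ) * X (N ∸ k))
      ≡⟨ Σ-ext k (λ d' → if-* (n ℕ.* suc d' ≡ᵇ k) (g (suc d')) (X (N ∸ k))) ⟩
    Σ< k (λ d' → if n ℕ.* suc d' ≡ᵇ k then g (suc d') * X (N ∸ k) else 0ℚ)
      ≡⟨ sym (Σ-extend k N (ℕₚ.≤-pred k≤N) (λ d' k≤d' _ → if-false (≡ᵇ-false (λ e →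
            ℕₚ.<-irrefl (sym e) (ℕₚ.<-≤-trans (s≤s k≤d') (ℕₚ.m≤n*m (suc d') n)))))) ⟩
    Σ< N (λ d' → if n ℕ.* suc d' ≡ᵇ k then g (suc d') * X (N ∸ k) else 0ℚ) ∎

dilate-multiple : ∀ n' q' (g : ℕ → ℚ) → dilate (suc n') g (suc q' ℕ.* suc n') ≡ g (suc q')
dilate-multiple n' q' g = begin
  Σ< K (λ d' → if n ℕ.* suc d' ≡ᵇ K then g (suc d') else 0ℚ)
    ≡⟨ Σ-single K q' (ℕₚ.<-≤-trans (ℕₚ.n<1+n q') (ℕₚ.m≤m*n (suc q') n))
         (λ k _ k≢q' → if-false (≡ᵇ-false (λ e → k≢q' (ℕₚ.suc-injective
              (ℕₚ.*-cancelˡ-≡ (suc k) (suc q') n (trans e (ℕₚ.*-comm (suc q') n))))))) ⟩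
  (if n ℕ.* suc q' ≡ᵇ K then g (suc q') else 0ℚ)
    ≡⟨ if-true (≡ᵇ-true (ℕₚ.*-comm n (suc q'))) ⟩
  g (suc q') ∎
  where
  n = suc n'
  K = suc q' ℕ.* suc n'

dilate-non-multiple : ∀ n (g : ℕ → ℚ) K → ¬ (n ∣ K) → dilate n g K ≡ 0ℚ
dilate-non-multiple n g K n∤K =
  Σ-zero K (λ d' _ → if-false (≡ᵇ-false (λ e → n∤K (divides (suc d') (trans (sym e) (ℕₚ.*-comm n (suc d')))))))

convolution : (ℕ → ℚ) → (ℕ → ℚ) → ℕ → ℚ
convolution g h D = Σ1to (D ∸ 1) (λ d → g d * h (D ∸ d))

module _ (n' : ℕ) (g h : ℕ → ℚ) where

  private
    n = suc n'

    product-term : ℕ → ℕ → ℚ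
    product-term K d' = if n ℕ.* suc d' ≤ᵇ K then g (suc d') * dilate n h (K ∸ n ℕ.* suc d') else 0ℚ

    -- If n ∤ K then K - nd is never a multiple of n.
    off-multiple : ∀ K → ¬ (n ∣ K) → Σ< K (product-term K) ≡ dilate n (convolution g h) K
    off-multiple K n∤K =
      trans (Σ-zero K (λ d' _ → term-vanishes d')) (sym (dilate-non-multiple n (convolution g h) K n∤K))
      where
      term-vanishes : ∀ d' → product-term K d' ≡ 0ℚ
      term-vanishes d' with n ℕ.* suc d' ≤? K
      ... | no  nd≰K = if-false (≤ᵇ-false nd≰K)
      ... | yes nd≤K = trans (if-true (≤ᵇ-true nd≤K)) (trans (cong (g (suc d') *_)
            (dilate-non-multiple n h (K ∸ n ℕ.* suc d')
              (λ n∣K-nd → n∤K (∣m∸n∣n⇒∣m n nd≤K n∣K-nd (divides (suc d') (ℕₚ.*-comm n (suc d')))))))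
            (ℚₚ.*-zeroʳ (g (suc d'))))

    -- For K = (q'+1)n the term of index d contributes g d · h (q'+1-d) when
    -- d ≤ q', and nothing otherwise.
    on-multiple : ∀ q' → Σ< (suc q' ℕ.* n) (product-term (suc q' ℕ.* n)) ≡ dilate n (convolution g h) (suc q' ℕ.* n)
    on-multiple q' = begin
      Σ< K' (product-term K')
        ≡⟨ Σ-extend q' K' (ℕₚ.≤-trans (ℕₚ.n≤1+n q') (ℕₚ.m≤m*n (suc q') n)) beyond ⟩
      Σ< q' (product-term K')
        ≡⟨ Σ-cong q' within ⟩
      Σ< q' (λ d' → g (suc d') * h (suc q' ∸ suc d'))
        ≡⟨ sym (dilate-multiple n' q' (convolution g h)) ⟩
      dilate n (convolution g h) K' ∎
      where
      K' = suc q' ℕ.* n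
      beyond : ∀ d' → q' ≤ d' → d' < K' → product-term K' d' ≡ 0ℚ
      beyond d' q'≤d' _ with ℕₚ.m≤n⇒m<n∨m≡n q'≤d'
      ... | inj₂ refl = trans (if-true (≤ᵇ-true (ℕₚ.≤-reflexive (ℕₚ.*-comm n (suc q')))))
              (trans (cong (λ x → g (suc q') * dilate n h x) (trans (cong (K' ∸_) (ℕₚ.*-comm n (suc q'))) (ℕₚ.n∸n≡0 K')))
                     (ℚₚ.*-zeroʳ (g (suc q'))))
      ... | inj₁ q'<d' = if-false (≤ᵇ-false (λ le → ℕₚ.<-irrefl refl (ℕₚ.<-≤-trans
              (ℕₚ.*-monoˡ-< n (s≤s q'<d')) (subst (_≤ K') (ℕₚ.*-comm n (suc d')) le))))
      within : ∀ d' → d' < q' → product-term K' d' ≡ g (suc d') * h (suc q' ∸ suc d')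
      within d' d'<q' = begin
        product-term K' d'
          ≡⟨ if-true (≤ᵇ-true (subst (_≤ K') (ℕₚ.*-comm (suc d') n) (ℕₚ.*-monoˡ-≤ n (ℕₚ.<⇒≤ (s≤s d'<q'))))) ⟩
        g (suc d') * dilate n h (K' ∸ n ℕ.* suc d')
          ≡⟨ cong (λ x → g (suc d') * dilate n h x) remaining ⟩
        g (suc d') * dilate n h (suc (q' ∸ suc d') ℕ.* n)
          ≡⟨ cong (g (suc d') *_) (dilate-multiple n' (q' ∸ suc d') h) ⟩
        g (suc d') * h (suc (q' ∸ suc d'))
          ≡⟨ cong (λ x → g (suc d') * h x) (sym (ℕₚ.+-∸-assoc 1 d'<q')) ⟩
        g (suc d') * h (suc q' ∸ suc d') ∎
        where
        remaining : K' ∸ n ℕ.* suc d' ≡ suc (q' ∸ suc d') ℕ.* n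
        remaining = begin
          suc q' ℕ.* n ∸ n ℕ.* suc d'     ≡⟨ cong (suc q' ℕ.* n ∸_) (ℕₚ.*-comm n (suc d')) ⟩
          suc q' ℕ.* n ∸ suc d' ℕ.* n     ≡⟨ sym (ℕₚ.*-distribʳ-∸ n (suc q') (suc d')) ⟩
          (q' ∸ d') ℕ.* n                 ≡⟨ cong (ℕ._* n) (ℕₚ.+-∸-assoc 1 d'<q') ⟩
          suc (q' ∸ suc d') ℕ.* n         ∎

    by-divisibility : ∀ K → Dec (n ∣ K) → Σ< K (product-term K) ≡ dilate n (convolution g h) K
    by-divisibility K (no n∤K)                 = off-multiple K n∤K
    by-divisibility K (yes (divides zero e))     rewrite e = refl
    by-divisibility K (yes (divides (suc q') e)) rewrite e = on-multiple q'

  dilate-product : ∀ K → (dilate n g ·ₛ dilate n h) K ≡ dilate n (convolution g h) K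
  dilate-product K = trans (sym (dilate-convolution n' g (dilate n h) K)) (by-divisibility K (n ∣? K))

dilate-cong : ∀ n (g h : ℕ → ℚ) K → (∀ d → g (suc d) ≡ h (suc d)) → dilate n g K ≡ dilate n h K
dilate-cong n g h K g≡h = Σ-ext K (λ d' → cong (λ x → if n ℕ.* suc d' ≡ᵇ K then x else 0ℚ) (g≡h d'))

dilate-+ : ∀ n (g h : ℕ → ℚ) K → dilate n (λ d → g d + h d) K ≡ dilate n g K + dilate n h K
dilate-+ n g h K = trans (Σ-ext K (λ d' → if-+ (n ℕ.* suc d' ≡ᵇ K) (g (suc d')) (h (suc d')))) (Σ-+ K _ _)

dilate-* : ∀ n (c : ℚ) (g : ℕ → ℚ) K → dilate n (λ d → c * g d) K ≡ c * dilate n g K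
dilate-* n c g K = trans (Σ-ext K (λ d' → if-c* (n ℕ.* suc d' ≡ᵇ K) c (g (suc d')))) (Σ-*ˡ K c _)

-- Passing from M to M+1 adds the terms with n₁ = M,
-- which factor as (level series of the first letter at M) · (truncated
-- bracket of the remaining letters).

weight : ℕ × ℕ → ℕ → ℕ → ℚ
weight (s , r) n d = (ℕ→ℚ (n ℕ.^ r) * ℕ→ℚ (d ℕ.^ (s ∸ 1))) * (invFact r * invFact (s ∸ 1))

-- Σ_{d ≥ 1} weight (s , r) n d q^{nd}: the terms of a depth-one bracket with n₁ = n.
level : ℕ × ℕ → ℕ → Series
level sr n = dilate n (weight sr n)

bracket-step : ∀ s r ps M N → bbAux ((s , r) ∷ ps) (suc (suc M)) N ≡
               bbAux ((s , r) ∷ ps) (suc M) N + (level (s , r) (suc M) ·ₛ bbAux ps (suc M)) N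
bracket-step s r ps M N =
  cong (bbAux ((s , r) ∷ ps) (suc M) N +_) (dilate-convolution M (weight (s , r) (suc M)) (bbAux ps (suc M)) N)

-- The coefficient of q^N only involves n₁ ≤ N, so any bound M > N gives the full bi-bracket.
bracket-bound : ∀ ps M N → suc N ≤ M → bbAux ps M N ≡ bbAux ps (suc N) N
bracket-bound []             M N N<M = refl
bracket-bound ((s , r) ∷ ps) M N N<M =
  Σ-extend N (M ∸ 1) (ℕₚ.∸-monoˡ-≤ 1 N<M) (λ k N≤k _ → Σ-zero N (λ d' _ → if-false (≤ᵇ-false (λ nd≤N →
    ℕₚ.<-irrefl refl (ℕₚ.<-≤-trans (s≤s N≤k) (ℕₚ.≤-trans (ℕₚ.m≤m*n (suc k) (suc d')) nd≤N))))))

bracketW : Word → ℕ → Series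
bracketW w M N = bbAux (map letterIdx w) M N

evalTrunc : Poly → ℕ → Series
evalTrunc []            M N = 0ℚ
evalTrunc ((c , w) ∷ p) M N = c * bracketW w M N + evalTrunc p M N

eval≡evalTrunc : ∀ p N → eval p N ≡ evalTrunc p (suc N) N
eval≡evalTrunc []            N = refl
eval≡evalTrunc ((c , w) ∷ p) N = cong (c * bracketW w (suc N) N +_) (eval≡evalTrunc p N)

evalTrunc-++ : ∀ p q M N → evalTrunc (p ++ q) M N ≡ evalTrunc p M N + evalTrunc q M N
evalTrunc-++ []            q M N = sym (ℚₚ.+-identityˡ _)
evalTrunc-++ ((c , w) ∷ p) q M N =
  trans (cong (c * bracketW w M N +_) (evalTrunc-++ p q M N))
        (sym (ℚₚ.+-assoc (c * bracketW w M N) (evalTrunc p M N) (evalTrunc q M N)))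

evalPrefixed : ℕ × ℕ → Poly → ℕ → Series
evalPrefixed sr []            M N = 0ℚ
evalPrefixed sr ((c , w) ∷ X) M N = c * bbAux (sr ∷ map letterIdx w) M N + evalPrefixed sr X M N

evalTrunc-prefix : ∀ e (H : ℚ × Word → ℚ × Word) → (∀ d v → H (d , v) ≡ (d , e ∷ v)) →
                   ∀ X M N → evalTrunc (map H X) M N ≡ evalPrefixed (letterIdx e) X M N
evalTrunc-prefix e H H≡ []            M N = refl
evalTrunc-prefix e H H≡ ((c , w) ∷ X) M N rewrite H≡ c w =
  cong (c * bracketW (e ∷ w) M N +_) (evalTrunc-prefix e H H≡ X M N)

-- No n₁ satisfies 0 < n₁ < M when M ≤ 1.
evalPrefixed-low : ∀ sr X M N → M ≤ 1 → evalPrefixed sr X M N ≡ 0ℚ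
evalPrefixed-low sr            []            M N M≤1 = refl
evalPrefixed-low (s , r) ((c , w) ∷ X) M N M≤1 =
  trans (cong₂ _+_ (trans (cong (c *_) (no-first-index M≤1)) (ℚₚ.*-zeroʳ c)) (evalPrefixed-low (s , r) X M N M≤1))
        (ℚₚ.+-identityˡ 0ℚ)
  where
  no-first-index : M ≤ 1 → bbAux ((s , r) ∷ map letterIdx w) M N ≡ 0ℚ
  no-first-index z≤n       = refl
  no-first-index (s≤s z≤n) = refl

evalPrefixed-step : ∀ sr X M N →
  evalPrefixed sr X (suc (suc M)) N ≡ evalPrefixed sr X (suc M) N + (level sr (suc M) ·ₛ evalTrunc X (suc M)) N
evalPrefixed-step sr []            M N =
  sym (trans (cong (0ℚ +_) (·-zeroʳ N (level sr (suc M)) (evalTrunc [] (suc M)) (λ _ → refl))) (ℚₚ.+-identityˡ 0ℚ))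
evalPrefixed-step (s , r) ((c , w) ∷ X) M N = begin
  c * bbAux ((s , r) ∷ ps) (suc (suc M)) N + evalPrefixed (s , r) X (suc (suc M)) N
    ≡⟨ cong₂ (λ x y → c * x + y) (bracket-step s r ps M N) (evalPrefixed-step (s , r) X M N) ⟩
  c * (B + S₁) + (E + S₂)
    ≡⟨ solve 5 (λ c b s e t → c :* (b :+ s) :+ (e :+ t) := (c :* b :+ e) :+ (c :* s :+ t)) refl c B S₁ E S₂ ⟩
  (c * B + E) + (c * S₁ + S₂)
    ≡⟨ cong ((c * B + E) +_) (sym (trans (·-+ʳ N (λ n → c * bbAux ps (suc M) n) (evalTrunc X (suc M)) σ)
                                         (cong (_+ S₂) (·-*ʳ N c (bbAux ps (suc M)) σ)))) ⟩
  (c * B + E) + (σ ·ₛ evalTrunc ((c , w) ∷ X) (suc M)) N ∎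
  where
  ps = map letterIdx w
  σ  = level (s , r) (suc M)
  B  = bbAux ((s , r) ∷ ps) (suc M) N
  S₁ = (σ ·ₛ bbAux ps (suc M)) N
  E  = evalPrefixed (s , r) X (suc M) N
  S₂ = (σ ·ₛ evalTrunc X (suc M)) N

prefixWith : Word → Poly → Poly
prefixWith w = map (λ { (d , v) → (d , w ++ v) })

evalConcat : Poly → Poly → ℕ → Series
evalConcat []            X M N = 0ℚ
evalConcat ((c , w) ∷ P) X M N = c * evalTrunc (prefixWith w X) M N + evalConcat P X M N

evalTrunc-·ᶜ : ∀ P X M N → evalTrunc (P ·ᶜ X) M N ≡ evalConcat P X M N
evalTrunc-·ᶜ []            X M N = refl
evalTrunc-·ᶜ ((c , w) ∷ P) X M N =
  trans (evalTrunc-++ (map _ X) (P ·ᶜ X) M N) (cong₂ _+_ (scaled-prefix X) (evalTrunc-·ᶜ P X M N))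
  where
  scaled-prefix : ∀ X → evalTrunc (map (λ { (d , v) → (c * d , w ++ v) }) X) M N ≡ c * evalTrunc (prefixWith w X) M N
  scaled-prefix []            = sym (ℚₚ.*-zeroʳ c)
  scaled-prefix ((d , v) ∷ X) =
    trans (cong (c * d * bracketW (w ++ v) M N +_) (scaled-prefix X))
          (solve 4 (λ c d b e → c :* d :* b :+ c :* e := c :* (d :* b :+ e)) refl c d (bracketW (w ++ v) M N) _)

evalConcat-++ : ∀ P Q X M N → evalConcat (P ++ Q) X M N ≡ evalConcat P X M N + evalConcat Q X M N
evalConcat-++ []            Q X M N = sym (ℚₚ.+-identityˡ _)
evalConcat-++ ((c , w) ∷ P) Q X M N =
  trans (cong (c * evalTrunc (prefixWith w X) M N +_) (evalConcat-++ P Q X M N))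
        (sym (ℚₚ.+-assoc (c * evalTrunc (prefixWith w X) M N) (evalConcat P X M N) (evalConcat Q X M N)))

evalConcat-scale : ∀ κ P X M N → evalConcat (scale κ P) X M N ≡ κ * evalConcat P X M N
evalConcat-scale κ []            X M N = sym (ℚₚ.*-zeroʳ κ)
evalConcat-scale κ ((c , w) ∷ P) X M N =
  trans (cong (κ * c * evalTrunc (prefixWith w X) M N +_) (evalConcat-scale κ P X M N))
        (solve 4 (λ k c b e → k :* c :* b :+ k :* e := k :* (c :* b :+ e)) refl
           κ c (evalTrunc (prefixWith w X) M N) (evalConcat P X M N))

evalConcat-family : ∀ n (f : ℕ → ℚ) (e : ℕ → Letter) (h : ℕ → ℕ) X M N →
  evalConcat (map (λ i → (f i , e i ∷ [])) (applyUpTo h n)) X M N ≡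
  Σ< n (λ i → f (h i) * evalPrefixed (letterIdx (e (h i))) X M N)
evalConcat-family zero    f e h X M N = refl
evalConcat-family (suc n) f e h X M N = begin
  f (h 0) * evalTrunc (prefixWith (e (h 0) ∷ []) X) M N
    + evalConcat (map (λ i → (f i , e i ∷ [])) (applyUpTo (λ x → h (suc x)) n)) X M N
    ≡⟨ cong (λ x → f (h 0) * x + rest) (prefix-one (h 0)) ⟩
  term (h 0) + evalConcat (map (λ i → (f i , e i ∷ [])) (applyUpTo (λ x → h (suc x)) n)) X M N
    ≡⟨ cong (term (h 0) +_) (evalConcat-family n f e (λ x → h (suc x)) X M N) ⟩
  term (h 0) + Σ< n (λ i → term (h (suc i)))
    ≡⟨ sym (Σ-head n (λ i → term (h i))) ⟩
  Σ< (suc n) (λ i → term (h i)) ∎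
  where
  rest = evalConcat (map (λ i → (f i , e i ∷ [])) (applyUpTo (λ x → h (suc x)) n)) X M N
  term : ℕ → ℚ
  term i = f i * evalPrefixed (letterIdx (e i)) X M N
  prefix-one : ∀ i → evalTrunc (prefixWith (e i ∷ []) X) M N ≡ evalPrefixed (letterIdx (e i)) X M N
  prefix-one i = evalTrunc-prefix (e i) _ (λ d v → refl) X M N

γ : ℕ → ℚ → ℚ
γ n x = pow x n * invFact n

γ-series : ℚ → Series
γ-series x n = γ n x

γ-suc : ∀ n x → ℕ→ℚ (suc n) * γ (suc n) x ≡ x * γ n x
γ-suc n x = begin
  ℕ→ℚ (suc n) * ((x * pow x n) * invFact (suc n))
    ≡⟨ solve 4 (λ s x w i → s :* ((x :* w) :* i) := x :* w :* (i :* s)) refl (ℕ→ℚ (suc n)) x (pow x n) (invFact (suc n)) ⟩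
  x * pow x n * (invFact (suc n) * ℕ→ℚ (suc n))
    ≡⟨ cong (x * pow x n *_) (invFact-suc n) ⟩
  x * pow x n * invFact n
    ≡⟨ ℚₚ.*-assoc x (pow x n) (invFact n) ⟩
  x * γ n x ∎

γ-zero : ∀ n → γ (suc n) 0ℚ ≡ 0ℚ
γ-zero n = trans (cong (_* invFact (suc n)) (pow-zero n)) (ℚₚ.*-zeroˡ (invFact (suc n)))

γ-weighted-left : ∀ n x y →
  Σ< (suc (suc n)) (λ i → ℕ→ℚ i * γ i x * γ (suc n ∸ i) y) ≡ x * (γ-series x ·ₛ γ-series y) n
γ-weighted-left n x y = begin
  Σ< (suc (suc n)) (λ i → ℕ→ℚ i * γ i x * γ (suc n ∸ i) y)
    ≡⟨ Σ-head (suc n) _ ⟩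
  ℕ→ℚ 0 * γ 0 x * γ (suc n) y + Σ< (suc n) (λ i → ℕ→ℚ (suc i) * γ (suc i) x * γ (n ∸ i) y)
    ≡⟨ cong₂ _+_ (solve 2 (λ a b → con 0ℚ :* a :* b := con 0ℚ) refl (γ 0 x) (γ (suc n) y))
                 (Σ-ext (suc n) (λ i → cong (_* γ (n ∸ i) y) (γ-suc i x))) ⟩
  0ℚ + Σ< (suc n) (λ i → x * γ i x * γ (n ∸ i) y)
    ≡⟨ ℚₚ.+-identityˡ _ ⟩
  Σ< (suc n) (λ i → x * γ i x * γ (n ∸ i) y)
    ≡⟨ Σ-ext (suc n) (λ i → ℚₚ.*-assoc x (γ i x) (γ (n ∸ i) y)) ⟩
  Σ< (suc n) (λ i → x * (γ i x * γ (n ∸ i) y))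
    ≡⟨ Σ-*ˡ (suc n) x _ ⟩
  x * (γ-series x ·ₛ γ-series y) n ∎

γ-weighted-right : ∀ n x y →
  Σ< (suc (suc n)) (λ i → γ i x * (ℕ→ℚ (suc n ∸ i) * γ (suc n ∸ i) y)) ≡ y * (γ-series x ·ₛ γ-series y) n
γ-weighted-right n x y = begin
  Σ< (suc n) (λ i → γ i x * (ℕ→ℚ (suc n ∸ i) * γ (suc n ∸ i) y))
    + γ (suc n) x * (ℕ→ℚ (suc n ∸ suc n) * γ (suc n ∸ suc n) y)
    ≡⟨ cong₂ _+_ (Σ-cong (suc n) (λ i i≤n → cong (λ t → γ i x * (ℕ→ℚ t * γ t y)) (ℕₚ.+-∸-assoc 1 (ℕₚ.≤-pred i≤n))))
                 (trans (cong (λ t → γ (suc n) x * (ℕ→ℚ t * γ t y)) (ℕₚ.n∸n≡0 n))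
                        (solve 2 (λ a b → a :* (con 0ℚ :* b) := con 0ℚ) refl (γ (suc n) x) (γ 0 y))) ⟩
  Σ< (suc n) (λ i → γ i x * (ℕ→ℚ (suc (n ∸ i)) * γ (suc (n ∸ i)) y)) + 0ℚ
    ≡⟨ ℚₚ.+-identityʳ _ ⟩
  Σ< (suc n) (λ i → γ i x * (ℕ→ℚ (suc (n ∸ i)) * γ (suc (n ∸ i)) y))
    ≡⟨ Σ-ext (suc n) (λ i → trans (cong (γ i x *_) (γ-suc (n ∸ i) y))
                       (solve 3 (λ a y b → a :* (y :* b) := y :* (a :* b)) refl (γ i x) y (γ (n ∸ i) y))) ⟩
  Σ< (suc n) (λ i → y * (γ i x * γ (n ∸ i) y))
    ≡⟨ Σ-*ˡ (suc n) y _ ⟩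
  y * (γ-series x ·ₛ γ-series y) n ∎

-- Both sides satisfy (n+1) f (n+1) = (x + y) f n, the right side by
-- splitting n+1 = i + (n+1-i) and applying γ-suc to each factor.
γ-binomial : ∀ n x y → γ n (x + y) ≡ (γ-series x ·ₛ γ-series y) n
γ-binomial zero    x y = refl
γ-binomial (suc n) x y = *-cancelˡ-suc n _ _ (begin
  ℕ→ℚ (suc n) * γ (suc n) (x + y)
    ≡⟨ γ-suc n (x + y) ⟩
  (x + y) * γ n (x + y)
    ≡⟨ cong ((x + y) *_) (γ-binomial n x y) ⟩
  (x + y) * conv
    ≡⟨ ℚₚ.*-distribʳ-+ conv x y ⟩
  x * conv + y * conv
    ≡⟨ cong₂ _+_ (sym (γ-weighted-left n x y)) (sym (γ-weighted-right n x y)) ⟩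
  Σ< (suc (suc n)) (λ i → ℕ→ℚ i * γ i x * γ (suc n ∸ i) y) +
  Σ< (suc (suc n)) (λ i → γ i x * (ℕ→ℚ (suc n ∸ i) * γ (suc n ∸ i) y))
    ≡⟨ sym (Σ-+ (suc (suc n)) _ _) ⟩
  Σ< (suc (suc n)) (λ i → ℕ→ℚ i * γ i x * γ (suc n ∸ i) y + γ i x * (ℕ→ℚ (suc n ∸ i) * γ (suc n ∸ i) y))
    ≡⟨ Σ-cong (suc (suc n)) (λ i i≤n+1 → trans
          (solve 4 (λ a b c d → a :* b :* c :+ b :* (d :* c) := (d :+ a) :* (b :* c)) refl
             (ℕ→ℚ i) (γ i x) (γ (suc n ∸ i) y) (ℕ→ℚ (suc n ∸ i)))
          (cong (_* (γ i x * γ (suc n ∸ i) y)) (ℕ→ℚ-∸ (ℕₚ.≤-pred i≤n+1)))) ⟩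
  Σ< (suc (suc n)) (λ i → ℕ→ℚ (suc n) * (γ i x * γ (suc n ∸ i) y))
    ≡⟨ Σ-*ˡ (suc (suc n)) (ℕ→ℚ (suc n)) _ ⟩
  ℕ→ℚ (suc n) * (γ-series x ·ₛ γ-series y) (suc n) ∎)
  where
  conv = (γ-series x ·ₛ γ-series y) n

γ-shift : ∀ n x → γ n (x + 1ℚ) ≡ Σ< (suc n) (λ i → γ i x * invFact (n ∸ i))
γ-shift n x = trans (γ-binomial n x 1ℚ) (Σ-ext (suc n) (λ i → cong (γ i x *_)
                (trans (cong (_* invFact (n ∸ i)) (pow-one (n ∸ i))) (ℚₚ.*-identityˡ _))))

-- The Bernoulli numbers λ_k.  Defs computes λ_{n+1} from λ_0 … λ_n by
-- λ_{n+1} = - Σ_{i ≤ n} λ_i / (n+2-i)!, which says that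
-- Σ_k λ_k x^k · (eˣ - 1)/x = 1.

lamUpTo-stable : ∀ n k → k ≤ n → lamUpTo n k ≡ lam k
lamUpTo-stable zero    .zero z≤n = refl
lamUpTo-stable (suc n) k k≤n+1 with k ≤? n
... | yes k≤n = trans (if-true (≤ᵇ-true k≤n)) (lamUpTo-stable n k k≤n)
... | no  k≰n with ℕₚ.≤-antisym k≤n+1 (ℕₚ.≰⇒> k≰n)
... | refl = refl

lam-suc : ∀ n → lam (suc n) ≡ - Σ< (suc n) (λ i → lam i * invFact (suc (suc n) ∸ i))
lam-suc n = trans (if-false (≤ᵇ-false {suc n} {n} (ℕₚ.<-irrefl refl)))
                  (cong -_ (Σ-cong (suc n) (λ i i≤n → cong (_* invFact (suc (suc n) ∸ i)) (lamUpTo-stable n i (ℕₚ.≤-pred i≤n)))))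

lam-recurrence : ∀ m → Σ< (suc m) (λ k → lam k * invFact (suc m ∸ k)) ≡ δ m
lam-recurrence zero    = refl
lam-recurrence (suc n) = begin
  A + lam (suc n) * invFact (suc (suc n) ∸ suc n)
    ≡⟨ cong₂ (λ u v → A + u * invFact v) (lam-suc n) (trans (ℕₚ.+-∸-assoc 1 (ℕₚ.≤-refl {n})) (cong suc (ℕₚ.n∸n≡0 n))) ⟩
  A + (- A) * invFact 1
    ≡⟨ solve 1 (λ a → a :+ (:- a) :* con 1ℚ := con 0ℚ) refl A ⟩
  0ℚ ∎
  where
  A = Σ< (suc n) (λ i → lam i * invFact (suc (suc n) ∸ i))

faulhaber-shift : ∀ k m x → lam k * γ (suc m) (x + 1ℚ) ≡
  lam k * γ (suc m) x + Σ< (suc m) (λ i → lam k * (γ i x * invFact (suc m ∸ i)))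
faulhaber-shift k m x = begin
  lam k * γ (suc m) (x + 1ℚ)
    ≡⟨ cong (lam k *_) (γ-shift (suc m) x) ⟩
  lam k * (Σ< (suc m) (λ i → γ i x * invFact (suc m ∸ i)) + γ (suc m) x * invFact (suc m ∸ suc m))
    ≡⟨ cong (λ t → lam k * (Σ< (suc m) (λ i → γ i x * invFact (suc m ∸ i)) + γ (suc m) x * invFact t)) (ℕₚ.n∸n≡0 m) ⟩
  lam k * (Σ< (suc m) (λ i → γ i x * invFact (suc m ∸ i)) + γ (suc m) x * 1ℚ)
    ≡⟨ solve 3 (λ l s q → l :* (s :+ q :* con 1ℚ) := l :* q :+ l :* s) refl
         (lam k) (Σ< (suc m) (λ i → γ i x * invFact (suc m ∸ i))) (γ (suc m) x) ⟩
  lam k * γ (suc m) x + lam k * Σ< (suc m) (λ i → γ i x * invFact (suc m ∸ i))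
    ≡⟨ cong (lam k * γ (suc m) x +_) (sym (Σ-*ˡ (suc m) (lam k) _)) ⟩
  lam k * γ (suc m) x + Σ< (suc m) (λ i → lam k * (γ i x * invFact (suc m ∸ i))) ∎

-- After exchanging the order of summation, lam-recurrence collapses the
-- inner sum to the single term i = b.
faulhaber-collapse : ∀ b i x → i ≤ b →
  Σ< (suc (b ∸ i)) (λ k → lam k * (γ i x * invFact (suc (b ∸ k) ∸ i))) ≡ γ i x * δ (b ∸ i)
faulhaber-collapse b i x i≤b = begin
  Σ< (suc (b ∸ i)) (λ k → lam k * (γ i x * invFact (suc (b ∸ k) ∸ i)))
    ≡⟨ Σ-cong (suc (b ∸ i)) (λ k k≤b-i → trans (cong (λ t → lam k * (γ i x * invFact t)) (reindex (ℕₚ.≤-pred k≤b-i)))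
          (solve 3 (λ l q f → l :* (q :* f) := q :* (l :* f)) refl (lam k) (γ i x) (invFact (suc (b ∸ i) ∸ k)))) ⟩
  Σ< (suc (b ∸ i)) (λ k → γ i x * (lam k * invFact (suc (b ∸ i) ∸ k)))
    ≡⟨ Σ-*ˡ (suc (b ∸ i)) (γ i x) _ ⟩
  γ i x * Σ< (suc (b ∸ i)) (λ k → lam k * invFact (suc (b ∸ i) ∸ k))
    ≡⟨ cong (γ i x *_) (lam-recurrence (b ∸ i)) ⟩
  γ i x * δ (b ∸ i) ∎
  where
  reindex : ∀ {k} → k ≤ b ∸ i → suc (b ∸ k) ∸ i ≡ suc (b ∸ i) ∸ k
  reindex {k} k≤b-i = begin
    suc (b ∸ k) ∸ i ≡⟨ ℕₚ.+-∸-assoc 1 (ℕₚ.m+n≤o⇒m≤o∸n i (subst (_≤ b) (ℕₚ.+-comm k i) (ℕₚ.m≤o∸n⇒m+n≤o k i≤b k≤b-i))) ⟩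
    suc (b ∸ k ∸ i) ≡⟨ cong suc (trans (ℕₚ.∸-+-assoc b k i) (trans (cong (b ∸_) (ℕₚ.+-comm k i)) (sym (ℕₚ.∸-+-assoc b i k)))) ⟩
    suc (b ∸ i ∸ k) ≡⟨ sym (ℕₚ.+-∸-assoc 1 k≤b-i) ⟩
    suc (b ∸ i) ∸ k ∎

-- By induction on D: the difference of the right side at D+1 and D is
-- γ b D by γ-shift, a change of summation order and lam-recurrence.
faulhaber : ∀ b D → Σ< D (λ e → γ b (ℕ→ℚ e)) ≡ Σ< (suc b) (λ k → lam k * γ (suc b ∸ k) (ℕ→ℚ D))
faulhaber b zero = sym (Σ-zero (suc b) (λ k k≤b → trans
  (cong (λ t → lam k * γ t 0ℚ) (ℕₚ.+-∸-assoc 1 (ℕₚ.≤-pred k≤b)))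
  (trans (cong (lam k *_) (γ-zero (b ∸ k))) (ℚₚ.*-zeroʳ (lam k)))))
faulhaber b (suc D) = sym (begin
  Σ< (suc b) (λ k → lam k * γ (suc b ∸ k) (ℕ→ℚ (suc D)))
    ≡⟨ Σ-cong (suc b) (λ k k≤b → trans (cong₂ (λ t y → lam k * γ t y) (ℕₚ.+-∸-assoc 1 (ℕₚ.≤-pred k≤b))
                                                                  (trans (ℕ→ℚ-suc D) (ℚₚ.+-comm 1ℚ x)))
                                        (faulhaber-shift k (b ∸ k) x)) ⟩
  Σ< (suc b) (λ k → lam k * γ (suc (b ∸ k)) x + Σ< (suc (b ∸ k)) (λ i → lam k * (γ i x * invFact (suc (b ∸ k) ∸ i))))
    ≡⟨ Σ-+ (suc b) _ _ ⟩
  Σ< (suc b) (λ k → lam k * γ (suc (b ∸ k)) x)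
    + Σ< (suc b) (λ k → Σ< (suc (b ∸ k)) (λ i → lam k * (γ i x * invFact (suc (b ∸ k) ∸ i))))
    ≡⟨ cong₂ _+_ (Σ-cong (suc b) (λ k k≤b → cong (λ t → lam k * γ t x) (sym (ℕₚ.+-∸-assoc 1 (ℕₚ.≤-pred k≤b)))))
                 (Σ-triangle′ b _) ⟩
  Σ< (suc b) (λ k → lam k * γ (suc b ∸ k) x)
    + Σ< (suc b) (λ i → Σ< (suc (b ∸ i)) (λ k → lam k * (γ i x * invFact (suc (b ∸ k) ∸ i))))
    ≡⟨ cong₂ _+_ (sym (faulhaber b D)) (Σ-cong (suc b) (λ i i≤b → faulhaber-collapse b i x (ℕₚ.≤-pred i≤b))) ⟩
  Σ< D (λ e → γ b (ℕ→ℚ e)) + Σ< (suc b) (λ i → γ i x * δ (b ∸ i))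
    ≡⟨ cong (Σ< D (λ e → γ b (ℕ→ℚ e)) +_) (Σ-single (suc b) b ℕₚ.≤-refl (λ i i≤b i≢b → trans (cong (γ i x *_)
          (if-false (≡ᵇ-false (λ e → i≢b (ℕₚ.≤-antisym (ℕₚ.≤-pred i≤b) (ℕₚ.m∸n≡0⇒m≤n e)))))) (ℚₚ.*-zeroʳ (γ i x)))) ⟩
  Σ< D (λ e → γ b (ℕ→ℚ e)) + γ b x * δ (b ∸ b)
    ≡⟨ cong (λ t → Σ< D (λ e → γ b (ℕ→ℚ e)) + γ b x * δ t) (ℕₚ.n∸n≡0 b) ⟩
  Σ< D (λ e → γ b (ℕ→ℚ e)) + γ b x * 1ℚ
    ≡⟨ cong (Σ< D (λ e → γ b (ℕ→ℚ e)) +_) (ℚₚ.*-identityʳ (γ b x)) ⟩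
  Σ< D (λ e → γ b (ℕ→ℚ e)) + γ b x ∎)
  where
  x = ℕ→ℚ D

-- Reflection of the Bernoulli numbers: (-1)^k λ_k = λ_k + [k = 1],
-- the coefficientwise form of x/(eˣ-1) evaluated at -x being x/(eˣ-1) + x.
-- Writing λ(x) = x/(eˣ-1), both sides times (eˣ-1)/x equal eˣ, and the
-- factor (eˣ-1)/x has constant term 1, so it can be cancelled.

-- The series eˣ, (eˣ-1)/x and (1-e⁻ˣ)/x.
expSeries : Series
expSeries n = invFact n

expQuot : Series
expQuot n = invFact (suc n)

expQuot⁻ : Series
expQuot⁻ n = signPow n * invFact (suc n)

-- Coefficients of λ(-x) and of λ(x) + x.
lam⁻ : Series
lam⁻ k = signPow k * lam k

lam+x : Series
lam+x k = lam k + (if k ≡ᵇ 1 then 1ℚ else 0ℚ)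

lam·expQuot : ∀ m → (lam ·ₛ expQuot) m ≡ δ m
lam·expQuot m = trans (Σ-cong (suc m) (λ k k≤m → cong (λ t → lam k * invFact t) (sym (ℕₚ.+-∸-assoc 1 (ℕₚ.≤-pred k≤m)))))
                      (lam-recurrence m)

-- Substituting x ↦ -x is multiplicative.
·-alternate : ∀ (f g : Series) m →
  ((λ k → signPow k * f k) ·ₛ (λ k → signPow k * g k)) m ≡ signPow m * (f ·ₛ g) m
·-alternate f g m = trans (Σ-cong (suc m) (λ k k≤m → begin
    signPow k * f k * (signPow (m ∸ k) * g (m ∸ k))
      ≡⟨ solve 4 (λ a b c d → a :* b :* (c :* d) := (a :* c) :* (b :* d)) refl (signPow k) (f k) (signPow (m ∸ k)) (g (m ∸ k)) ⟩
    (signPow k * signPow (m ∸ k)) * (f k * g (m ∸ k))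
      ≡⟨ cong (_* (f k * g (m ∸ k))) (trans (sym (signPow-+ k (m ∸ k))) (cong signPow (ℕₚ.m+[n∸m]≡n (ℕₚ.≤-pred k≤m)))) ⟩
    signPow m * (f k * g (m ∸ k)) ∎))
  (Σ-*ˡ (suc m) (signPow m) _)

lam⁻·expQuot⁻ : ∀ m → (lam⁻ ·ₛ expQuot⁻) m ≡ δ m
lam⁻·expQuot⁻ m = trans (·-alternate lam expQuot m) (trans (cong (signPow m *_) (lam·expQuot m)) (sign-δ m))
  where
  sign-δ : ∀ m → signPow m * δ m ≡ δ m
  sign-δ zero    = refl
  sign-δ (suc m) = ℚₚ.*-zeroʳ (signPow (suc m))

-- eˣ · (1-e⁻ˣ)/x = (eˣ-1)/x: this is γ (m+1) (1 + (-1)) = 0 expanded by the binomial theorem.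
exp·expQuot⁻ : ∀ m → (expSeries ·ₛ expQuot⁻) m ≡ expQuot m
exp·expQuot⁻ m = +-cancelˡ (- (expSeries ·ₛ expQuot⁻) m) _ _ (begin
  - (expSeries ·ₛ expQuot⁻) m + (expSeries ·ₛ expQuot⁻) m
    ≡⟨ ℚₚ.+-inverseˡ ((expSeries ·ₛ expQuot⁻) m) ⟩
  0ℚ
    ≡⟨ sym (γ-zero m) ⟩
  γ (suc m) 0ℚ
    ≡⟨ γ-binomial (suc m) 1ℚ (- 1ℚ) ⟩
  Σ< (suc m) (λ i → γ i 1ℚ * γ (suc m ∸ i) (- 1ℚ)) + γ (suc m) 1ℚ * γ (suc m ∸ suc m) (- 1ℚ)
    ≡⟨ cong₂ _+_ (Σ-cong (suc m) (λ i i≤m → trans (cong (λ t → γ i 1ℚ * γ t (- 1ℚ)) (ℕₚ.+-∸-assoc 1 (ℕₚ.≤-pred i≤m)))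
                                                 (mixed-term i)))
                 (trans (cong (λ t → γ (suc m) 1ℚ * γ t (- 1ℚ)) (ℕₚ.n∸n≡0 m))
                        (trans (cong (λ u → u * invFact (suc m) * 1ℚ) (pow-one (suc m)))
                               (solve 1 (λ a → con 1ℚ :* a :* con 1ℚ := a) refl (invFact (suc m))))) ⟩
  Σ< (suc m) (λ i → - (expSeries i * expQuot⁻ (m ∸ i))) + expQuot m
    ≡⟨ cong (_+ expQuot m) (Σ-neg (suc m) _) ⟩
  - (expSeries ·ₛ expQuot⁻) m + expQuot m ∎)
  where
  mixed-term : ∀ i → γ i 1ℚ * γ (suc (m ∸ i)) (- 1ℚ) ≡ - (expSeries i * expQuot⁻ (m ∸ i))
  mixed-term i = begin
    pow 1ℚ i * invFact i * (pow (- 1ℚ) (suc (m ∸ i)) * invFact (suc (m ∸ i)))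
      ≡⟨ cong₂ (λ u v → u * invFact i * (v * invFact (suc (m ∸ i)))) (pow-one i) (pow-minus-one (suc (m ∸ i))) ⟩
    1ℚ * invFact i * (- signPow (m ∸ i) * invFact (suc (m ∸ i)))
      ≡⟨ solve 3 (λ a s b → con 1ℚ :* a :* (:- s :* b) := :- (a :* (s :* b))) refl
           (invFact i) (signPow (m ∸ i)) (invFact (suc (m ∸ i))) ⟩
    - (expSeries i * expQuot⁻ (m ∸ i)) ∎

lam⁻·expQuot : ∀ m → (lam⁻ ·ₛ expQuot) m ≡ expSeries m
lam⁻·expQuot m = begin
  (lam⁻ ·ₛ expQuot) m                          ≡⟨ ·-congʳ m lam⁻ (λ k → sym (exp·expQuot⁻ k)) ⟩
  (lam⁻ ·ₛ (expSeries ·ₛ expQuot⁻)) m          ≡⟨ sym (·-assoc m lam⁻ expSeries expQuot⁻) ⟩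
  ((lam⁻ ·ₛ expSeries) ·ₛ expQuot⁻) m          ≡⟨ ·-congˡ m expQuot⁻ (λ k → ·-comm k lam⁻ expSeries) ⟩
  ((expSeries ·ₛ lam⁻) ·ₛ expQuot⁻) m          ≡⟨ ·-assoc m expSeries lam⁻ expQuot⁻ ⟩
  (expSeries ·ₛ (lam⁻ ·ₛ expQuot⁻)) m          ≡⟨ ·-congʳ m expSeries lam⁻·expQuot⁻ ⟩
  (expSeries ·ₛ δ) m                           ≡⟨ ·-unitʳ m expSeries ⟩
  expSeries m                                  ∎

lam+x·expQuot : ∀ m → (lam+x ·ₛ expQuot) m ≡ expSeries m
lam+x·expQuot m = trans (·-+ˡ m lam x expQuot) (trans (cong (_+ (x ·ₛ expQuot) m) (lam·expQuot m)) (add-x m))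
  where
  x : Series
  x k = if k ≡ᵇ 1 then 1ℚ else 0ℚ
  add-x : ∀ m → δ m + (x ·ₛ expQuot) m ≡ expSeries m
  add-x zero    = refl
  add-x (suc n) = trans (ℚₚ.+-identityˡ _) (trans
    (Σ-single (suc (suc n)) 1 (s≤s (s≤s z≤n))
       (λ k _ k≢1 → trans (cong (_* expQuot (suc n ∸ k)) (if-false (≡ᵇ-false k≢1))) (ℚₚ.*-zeroˡ (expQuot (suc n ∸ k)))))
    (ℚₚ.*-identityˡ _))

·-cancelʳ : ∀ (E f g : Series) → E 0 ≡ 1ℚ → (∀ m → (f ·ₛ E) m ≡ (g ·ₛ E) m) → ∀ m → f m ≡ g m
·-cancelʳ E f g E₀≡1 fE≡gE m = below (suc m) m ℕₚ.≤-refl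
  where
  next : ∀ m → (∀ k → k < m → f k ≡ g k) → f m ≡ g m
  next m agree = begin
    f m               ≡⟨ sym (ℚₚ.*-identityʳ (f m)) ⟩
    f m * 1ℚ          ≡⟨ cong (f m *_) (sym leading) ⟩
    f m * E (m ∸ m)   ≡⟨ +-cancelˡ (Σ< m (λ k → g k * E (m ∸ k))) _ _
                           (trans (cong (_+ f m * E (m ∸ m)) (Σ-cong m (λ k k<m → cong (_* E (m ∸ k)) (sym (agree k k<m)))))
                                  (fE≡gE m)) ⟩
    g m * E (m ∸ m)   ≡⟨ cong (g m *_) leading ⟩
    g m * 1ℚ          ≡⟨ ℚₚ.*-identityʳ (g m) ⟩
    g m               ∎
    where
    leading : E (m ∸ m) ≡ 1ℚ
    leading = trans (cong E (ℕₚ.n∸n≡0 m)) E₀≡1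
  below : ∀ m k → k < m → f k ≡ g k
  below (suc m) k k≤m with ℕₚ.m≤n⇒m<n∨m≡n (ℕₚ.≤-pred k≤m)
  ... | inj₁ k<m  = below m k k<m
  ... | inj₂ refl = next k (below k)

lam-reflection : ∀ k → lam⁻ k ≡ lam+x k
lam-reflection = ·-cancelʳ expQuot lam⁻ lam+x refl (λ m → trans (lam⁻·expQuot m) (sym (lam+x·expQuot m)))

-- The form in which reflection is used: (-1)^b λ_{b+1} + λ_{b+1} + γ b 0 = 0.
-- Both [b = 0] terms, from λ_1 = -1/2 and from γ 0 0 = 1, cancel.
lam-reflection-at-suc : ∀ b → signPow b * lam (suc b) + lam (suc b) + γ b 0ℚ ≡ 0ℚ
lam-reflection-at-suc b = begin
  signPow b * L + L + γ b 0ℚ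
    ≡⟨ cong₂ (λ u v → u + L + v) flip (γ-at-zero b) ⟩
  - (L + I) + L + I
    ≡⟨ solve 2 (λ l i → :- (l :+ i) :+ l :+ i := con 0ℚ) refl L I ⟩
  0ℚ ∎
  where
  L = lam (suc b)
  I = if suc b ≡ᵇ 1 then 1ℚ else 0ℚ
  flip : signPow b * L ≡ - (L + I)
  flip = trans (solve 2 (λ s l → s :* l := :- ((:- s) :* l)) refl (signPow b) L) (cong -_ (lam-reflection (suc b)))
  γ-at-zero : ∀ b → γ b 0ℚ ≡ (if suc b ≡ᵇ 1 then 1ℚ else 0ℚ)
  γ-at-zero zero    = refl
  γ-at-zero (suc b) = γ-zero b

-- For D ≥ 1,
--   Σ_{0<d<D} γ a d · γ b (D-d) = γ (a+b+1) D + (-1)^b Λ a b D + (-1)^a Λ b a D,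
-- where Λ a b x = Σ_{u ≤ a} (u+b)!/(u! b!) λ_{u+b+1} γ (a-u) x.  This is the
-- arithmetic core of the diamond product.  Both sides satisfy the recurrence
--   (a+1) f (a+1) b + (b+1) f a (b+1) = D · f a b,
-- so by induction on a it suffices to treat a = 0, which is Faulhaber's
-- formula combined with the reflection of the Bernoulli numbers.

tailTerm : ℕ → ℕ → ℚ → ℕ → ℚ
tailTerm a b x u = multinomial u b * lam (suc (u ℕ.+ b)) * γ (a ∸ u) x

tailΛ : ℕ → ℕ → ℚ → ℚ
tailΛ a b x = Σ< (suc a) (tailTerm a b x)

convPoly : ℕ → ℕ → ℚ → ℚ
convPoly a b x = γ (suc (a ℕ.+ b)) x + signPow b * tailΛ a b x + signPow a * tailΛ b a x

convPow : ℕ → ℕ → ℕ → ℚ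
convPow a b D = Σ1to (D ∸ 1) (λ d → γ a (ℕ→ℚ d) * γ b (ℕ→ℚ (D ∸ d)))

multinomial-shift : ∀ u b → ℕ→ℚ (suc b) * multinomial u (suc b) ≡ ℕ→ℚ (suc u) * multinomial (suc u) b
multinomial-shift u b = begin
  ℕ→ℚ (suc b) * (F1 * invFact u * invFact (suc b))
    ≡⟨ solve 4 (λ s f i j → s :* (f :* i :* j) := f :* i :* (j :* s)) refl (ℕ→ℚ (suc b)) F1 (invFact u) (invFact (suc b)) ⟩
  F1 * invFact u * (invFact (suc b) * ℕ→ℚ (suc b))
    ≡⟨ cong₂ (λ f t → f * invFact u * t) (cong (λ n → ℕ→ℚ (n !)) (ℕₚ.+-suc u b)) (invFact-suc b) ⟩
  F2 * invFact u * invFact b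
    ≡⟨ cong (λ t → F2 * t * invFact b) (sym (invFact-suc u)) ⟩
  F2 * (invFact (suc u) * ℕ→ℚ (suc u)) * invFact b
    ≡⟨ solve 4 (λ f i s j → f :* (i :* s) :* j := s :* (f :* i :* j)) refl F2 (invFact (suc u)) (ℕ→ℚ (suc u)) (invFact b) ⟩
  ℕ→ℚ (suc u) * (F2 * invFact (suc u) * invFact b) ∎
  where
  F1 = ℕ→ℚ ((u ℕ.+ suc b) !)
  F2 = ℕ→ℚ ((suc u ℕ.+ b) !)

-- Splitting (a+1) = (a+1-u) + u in the u-th term of (a+1) Λ (a+1) b:
-- the first part lowers the divided power, the second shifts the multinomial.
tailΛ-lower : ∀ a b x → Σ< (suc (suc a)) (λ u → ℕ→ℚ (suc a ∸ u) * tailTerm (suc a) b x u) ≡ x * tailΛ a b x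
tailΛ-lower a b x = begin
  Σ< (suc a) (λ u → ℕ→ℚ (suc a ∸ u) * tailTerm (suc a) b x u) + ℕ→ℚ (suc a ∸ suc a) * tailTerm (suc a) b x (suc a)
    ≡⟨ cong₂ _+_ (Σ-cong (suc a) (λ u u≤a → lower-term u (ℕₚ.≤-pred u≤a)))
                 (trans (cong (λ t → ℕ→ℚ t * tailTerm (suc a) b x (suc a)) (ℕₚ.n∸n≡0 (suc a)))
                        (ℚₚ.*-zeroˡ (tailTerm (suc a) b x (suc a)))) ⟩
  Σ< (suc a) (λ u → x * tailTerm a b x u) + 0ℚ
    ≡⟨ ℚₚ.+-identityʳ _ ⟩
  Σ< (suc a) (λ u → x * tailTerm a b x u)
    ≡⟨ Σ-*ˡ (suc a) x _ ⟩
  x * tailΛ a b x ∎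
  where
  lower-term : ∀ u → u ≤ a → ℕ→ℚ (suc a ∸ u) * tailTerm (suc a) b x u ≡ x * tailTerm a b x u
  lower-term u u≤a = begin
    ℕ→ℚ (suc a ∸ u) * (c * γ (suc a ∸ u) x)
      ≡⟨ cong (λ t → ℕ→ℚ t * (c * γ t x)) (ℕₚ.+-∸-assoc 1 u≤a) ⟩
    ℕ→ℚ (suc (a ∸ u)) * (c * γ (suc (a ∸ u)) x)
      ≡⟨ solve 3 (λ s c q → s :* (c :* q) := c :* (s :* q)) refl (ℕ→ℚ (suc (a ∸ u))) c (γ (suc (a ∸ u)) x) ⟩
    c * (ℕ→ℚ (suc (a ∸ u)) * γ (suc (a ∸ u)) x)
      ≡⟨ cong (c *_) (γ-suc (a ∸ u) x) ⟩
    c * (x * γ (a ∸ u) x)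
      ≡⟨ solve 3 (λ c x q → c :* (x :* q) := x :* (c :* q)) refl c x (γ (a ∸ u) x) ⟩
    x * (c * γ (a ∸ u) x) ∎
    where c = multinomial u b * lam (suc (u ℕ.+ b))

tailΛ-shift : ∀ a b x → Σ< (suc (suc a)) (λ u → ℕ→ℚ u * tailTerm (suc a) b x u) ≡ ℕ→ℚ (suc b) * tailΛ a (suc b) x
tailΛ-shift a b x = begin
  Σ< (suc (suc a)) (λ u → ℕ→ℚ u * tailTerm (suc a) b x u)
    ≡⟨ Σ-head (suc a) _ ⟩
  0ℚ * tailTerm (suc a) b x 0 + Σ< (suc a) (λ u → ℕ→ℚ (suc u) * tailTerm (suc a) b x (suc u))
    ≡⟨ cong₂ _+_ (ℚₚ.*-zeroˡ (tailTerm (suc a) b x 0)) (Σ-ext (suc a) shift-term) ⟩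
  0ℚ + Σ< (suc a) (λ u → ℕ→ℚ (suc b) * tailTerm a (suc b) x u)
    ≡⟨ ℚₚ.+-identityˡ _ ⟩
  Σ< (suc a) (λ u → ℕ→ℚ (suc b) * tailTerm a (suc b) x u)
    ≡⟨ Σ-*ˡ (suc a) (ℕ→ℚ (suc b)) _ ⟩
  ℕ→ℚ (suc b) * tailΛ a (suc b) x ∎
  where
  shift-term : ∀ u → ℕ→ℚ (suc u) * tailTerm (suc a) b x (suc u) ≡ ℕ→ℚ (suc b) * tailTerm a (suc b) x u
  shift-term u = begin
    ℕ→ℚ (suc u) * (multinomial (suc u) b * lam (suc (suc u ℕ.+ b)) * q)
      ≡⟨ solve 4 (λ s c l q → s :* (c :* l :* q) := s :* c :* l :* q) refl
           (ℕ→ℚ (suc u)) (multinomial (suc u) b) (lam (suc (suc u ℕ.+ b))) q ⟩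
    ℕ→ℚ (suc u) * multinomial (suc u) b * lam (suc (suc u ℕ.+ b)) * q
      ≡⟨ cong₂ (λ c l → c * l * q) (sym (multinomial-shift u b)) (cong (λ t → lam (suc t)) (sym (ℕₚ.+-suc u b))) ⟩
    ℕ→ℚ (suc b) * multinomial u (suc b) * lam (suc (u ℕ.+ suc b)) * q
      ≡⟨ solve 4 (λ s c l q → s :* c :* l :* q := s :* (c :* l :* q)) refl
           (ℕ→ℚ (suc b)) (multinomial u (suc b)) (lam (suc (u ℕ.+ suc b))) q ⟩
    ℕ→ℚ (suc b) * (multinomial u (suc b) * lam (suc (u ℕ.+ suc b)) * q) ∎
    where q = γ (a ∸ u) x

tailΛ-recurrence : ∀ a b x → ℕ→ℚ (suc a) * tailΛ (suc a) b x ≡ x * tailΛ a b x + ℕ→ℚ (suc b) * tailΛ a (suc b) x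
tailΛ-recurrence a b x = begin
  ℕ→ℚ (suc a) * tailΛ (suc a) b x
    ≡⟨ sym (Σ-*ˡ (suc (suc a)) (ℕ→ℚ (suc a)) _) ⟩
  Σ< (suc (suc a)) (λ u → ℕ→ℚ (suc a) * tailTerm (suc a) b x u)
    ≡⟨ Σ-cong (suc (suc a)) (λ u u≤a+1 → trans (cong (_* tailTerm (suc a) b x u) (sym (ℕ→ℚ-∸ (ℕₚ.≤-pred u≤a+1))))
                                                (ℚₚ.*-distribʳ-+ (tailTerm (suc a) b x u) (ℕ→ℚ (suc a ∸ u)) (ℕ→ℚ u))) ⟩
  Σ< (suc (suc a)) (λ u → ℕ→ℚ (suc a ∸ u) * tailTerm (suc a) b x u + ℕ→ℚ u * tailTerm (suc a) b x u)
    ≡⟨ Σ-+ (suc (suc a)) _ _ ⟩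
  Σ< (suc (suc a)) (λ u → ℕ→ℚ (suc a ∸ u) * tailTerm (suc a) b x u)
    + Σ< (suc (suc a)) (λ u → ℕ→ℚ u * tailTerm (suc a) b x u)
    ≡⟨ cong₂ _+_ (tailΛ-lower a b x) (tailΛ-shift a b x) ⟩
  x * tailΛ a b x + ℕ→ℚ (suc b) * tailΛ a (suc b) x ∎

convPoly-recurrence : ∀ a b x → ℕ→ℚ (suc a) * convPoly (suc a) b x + ℕ→ℚ (suc b) * convPoly a (suc b) x ≡ x * convPoly a b x
convPoly-recurrence a b x = begin
  A1 * (P1 + sb * Ua1b + (- sa) * Uba1) + B1 * (P1' + (- sb) * Uab1 + sa * Ub1a)
    ≡⟨ cong (λ t → A1 * (P1 + sb * Ua1b + (- sa) * Uba1) + B1 * (t + (- sb) * Uab1 + sa * Ub1a)) (cong (λ n → γ (suc n) x) (ℕₚ.+-suc a b)) ⟩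
  A1 * (P1 + sb * Ua1b + (- sa) * Uba1) + B1 * (P1 + (- sb) * Uab1 + sa * Ub1a)
    ≡⟨ solve 9 (λ A1 B1 P1 sa sb Ua1b Uba1 Uab1 Ub1a →
          A1 :* (P1 :+ sb :* Ua1b :+ (:- sa) :* Uba1) :+ B1 :* (P1 :+ (:- sb) :* Uab1 :+ sa :* Ub1a)
          := (A1 :+ B1) :* P1 :+ sb :* (A1 :* Ua1b) :- sb :* (B1 :* Uab1) :+ sa :* (B1 :* Ub1a) :- sa :* (A1 :* Uba1))
          refl A1 B1 P1 sa sb Ua1b Uba1 Uab1 Ub1a ⟩
  (A1 + B1) * P1 + sb * (A1 * Ua1b) - sb * (B1 * Uab1) + sa * (B1 * Ub1a) - sa * (A1 * Uba1)
    ≡⟨ cong₂ (λ u v → u + sb * v - sb * (B1 * Uab1) + sa * (B1 * Ub1a) - sa * (A1 * Uba1)) top-degree (tailΛ-recurrence a b x) ⟩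
  x * P0 + sb * (x * Uab + B1 * Uab1) - sb * (B1 * Uab1) + sa * (B1 * Ub1a) - sa * (A1 * Uba1)
    ≡⟨ cong (λ v → x * P0 + sb * (x * Uab + B1 * Uab1) - sb * (B1 * Uab1) + sa * v - sa * (A1 * Uba1)) (tailΛ-recurrence b a x) ⟩
  x * P0 + sb * (x * Uab + B1 * Uab1) - sb * (B1 * Uab1) + sa * (x * Uba + A1 * Uba1) - sa * (A1 * Uba1)
    ≡⟨ solve 9 (λ x P0 sb Uab B1 Uab1 sa Uba AU →
          x :* P0 :+ sb :* (x :* Uab :+ B1 :* Uab1) :- sb :* (B1 :* Uab1) :+ sa :* (x :* Uba :+ AU) :- sa :* AU
          := x :* (P0 :+ sb :* Uab :+ sa :* Uba)) refl x P0 sb Uab B1 Uab1 sa Uba (A1 * Uba1) ⟩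
  x * convPoly a b x ∎
  where
  A1 = ℕ→ℚ (suc a)
  B1 = ℕ→ℚ (suc b)
  P1 = γ (suc (suc (a ℕ.+ b))) x
  P1' = γ (suc (a ℕ.+ suc b)) x
  P0 = γ (suc (a ℕ.+ b)) x
  sa = signPow a
  sb = signPow b
  Ua1b = tailΛ (suc a) b x
  Uba1 = tailΛ b (suc a) x
  Uab1 = tailΛ a (suc b) x
  Ub1a = tailΛ (suc b) a x
  Uab = tailΛ a b x
  Uba = tailΛ b a x
  top-degree : (A1 + B1) * P1 ≡ x * P0
  top-degree = trans (cong (_* P1) (trans (sym (ℕ→ℚ-+ (suc a) (suc b))) (cong ℕ→ℚ (cong suc (ℕₚ.+-suc a b))))) (γ-suc (suc (a ℕ.+ b)) x)

-- The recurrence for the convolution side: d + (D - d) = D termwise.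
convPow-recurrence : ∀ a b D → ℕ→ℚ (suc a) * convPow (suc a) b D + ℕ→ℚ (suc b) * convPow a (suc b) D ≡ ℕ→ℚ D * convPow a b D
convPow-recurrence a b D = begin
  ℕ→ℚ (suc a) * convPow (suc a) b D + ℕ→ℚ (suc b) * convPow a (suc b) D
    ≡⟨ sym (cong₂ _+_ (Σ-*ˡ (D ∸ 1) (ℕ→ℚ (suc a)) _) (Σ-*ˡ (D ∸ 1) (ℕ→ℚ (suc b)) _)) ⟩
  Σ< (D ∸ 1) (λ d → ℕ→ℚ (suc a) * (γ (suc a) (y d) * γ b (z' d))) + Σ< (D ∸ 1) (λ d → ℕ→ℚ (suc b) * (γ a (y d) * γ (suc b) (z' d)))
    ≡⟨ sym (Σ-+ (D ∸ 1) _ _) ⟩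
  Σ< (D ∸ 1) (λ d → ℕ→ℚ (suc a) * (γ (suc a) (y d) * γ b (z' d)) + ℕ→ℚ (suc b) * (γ a (y d) * γ (suc b) (z' d)))
    ≡⟨ Σ-cong (D ∸ 1) term ⟩
  Σ< (D ∸ 1) (λ d → ℕ→ℚ D * (γ a (y d) * γ b (z' d)))
    ≡⟨ Σ-*ˡ (D ∸ 1) (ℕ→ℚ D) _ ⟩
  ℕ→ℚ D * convPow a b D ∎
  where
  y : ℕ → ℚ
  y d = ℕ→ℚ (suc d)
  z' : ℕ → ℚ
  z' d = ℕ→ℚ (D ∸ suc d)
  term : ∀ d → d < D ∸ 1 → ℕ→ℚ (suc a) * (γ (suc a) (y d) * γ b (z' d)) + ℕ→ℚ (suc b) * (γ a (y d) * γ (suc b) (z' d))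
                         ≡ ℕ→ℚ D * (γ a (y d) * γ b (z' d))
  term d d<D-1 = begin
    ℕ→ℚ (suc a) * (γ (suc a) (y d) * γ b (z' d)) + ℕ→ℚ (suc b) * (γ a (y d) * γ (suc b) (z' d))
      ≡⟨ solve 6 (λ A P Q B R T → A :* (P :* Q) :+ B :* (R :* T) := (A :* P) :* Q :+ R :* (B :* T)) refl
           (ℕ→ℚ (suc a)) (γ (suc a) (y d)) (γ b (z' d)) (ℕ→ℚ (suc b)) (γ a (y d)) (γ (suc b) (z' d)) ⟩
    (ℕ→ℚ (suc a) * γ (suc a) (y d)) * γ b (z' d) + γ a (y d) * (ℕ→ℚ (suc b) * γ (suc b) (z' d))
      ≡⟨ cong₂ (λ u v → u * γ b (z' d) + γ a (y d) * v) (γ-suc a (y d)) (γ-suc b (z' d)) ⟩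
    (y d * γ a (y d)) * γ b (z' d) + γ a (y d) * (z' d * γ b (z' d))
      ≡⟨ solve 4 (λ y P Q z → (y :* P) :* Q :+ P :* (z :* Q) := (z :+ y) :* (P :* Q)) refl (y d) (γ a (y d)) (γ b (z' d)) (z' d) ⟩
    (z' d + y d) * (γ a (y d) * γ b (z' d))
      ≡⟨ cong (_* (γ a (y d) * γ b (z' d))) (ℕ→ℚ-∸ (ℕₚ.≤-trans d<D-1 (ℕₚ.m∸n≤m D 1))) ⟩
    ℕ→ℚ D * (γ a (y d) * γ b (z' d)) ∎

multinomial-zeroʳ : ∀ u → multinomial u 0 ≡ 1ℚ
multinomial-zeroʳ u = begin
  ℕ→ℚ ((u ℕ.+ 0) !) * invFact u * 1ℚ ≡⟨ cong (λ n → ℕ→ℚ (n !) * invFact u * 1ℚ) (ℕₚ.+-identityʳ u) ⟩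
  ℕ→ℚ (u !) * invFact u * 1ℚ           ≡⟨ solve 2 (λ f i → f :* i :* con 1ℚ := i :* f) refl (ℕ→ℚ (u !)) (invFact u) ⟩
  invFact u * ℕ→ℚ (u !)                ≡⟨ invFact-! u ⟩
  1ℚ                                   ∎

multinomial-zeroˡ : ∀ b → multinomial 0 b ≡ 1ℚ
multinomial-zeroˡ b = trans (solve 2 (λ f i → f :* con 1ℚ :* i := i :* f) refl (ℕ→ℚ (b !)) (invFact b)) (invFact-! b)

-- a = 0: the left side is Σ_{0<e<D} γ b e, given by Faulhaber's formula.
convPow≡convPoly-base : ∀ b D0 → convPow 0 b (suc D0) ≡ convPoly 0 b (ℕ→ℚ (suc D0))
convPow≡convPoly-base b D0 = begin
  convPow 0 b (suc D0)
    ≡⟨ Σ-ext D0 (λ d' → ℚₚ.*-identityˡ _) ⟩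
  Σ< D0 (λ d' → γ b (ℕ→ℚ (D0 ∸ d')))
    ≡⟨ sym (trans (Σ-reverse D0 (λ k → γ b (ℕ→ℚ (suc k))))
                  (Σ-cong D0 (λ k k<D0 → cong (λ t → γ b (ℕ→ℚ t)) (sym (ℕₚ.+-∸-assoc 1 k<D0))))) ⟩
  Sb
    ≡⟨ sym (ℚₚ.+-identityʳ Sb) ⟩
  Sb + 0ℚ
    ≡⟨ cong (Sb +_) (sym (lam-reflection-at-suc b)) ⟩
  Sb + (sb * L + L + pb0)
    ≡⟨ solve 4 (λ s a l q → s :+ (a :* l :+ l :+ q) := (q :+ s) :+ a :* l :+ l) refl Sb sb L pb0 ⟩
  (pb0 + Sb) + sb * L + L
    ≡⟨ cong (λ t → t + sb * L + L) faulhaber-split ⟩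
  (1ℚ * P + Σb) + sb * L + L
    ≡⟨ solve 4 (λ P q a l → (con 1ℚ :* P :+ q) :+ a :* l :+ l := P :+ a :* l :+ con 1ℚ :* (q :+ l)) refl P Σb sb L ⟩
  P + sb * L + 1ℚ * (Σb + L)
    ≡⟨ cong₂ (λ u v → P + sb * u + 1ℚ * v) (sym tail-0b) (sym tail-b0) ⟩
  convPoly 0 b X ∎
  where
  X = ℕ→ℚ (suc D0)
  Sb = Σ< D0 (λ k → γ b (ℕ→ℚ (suc k)))
  sb = signPow b
  L = lam (suc b)
  pb0 = γ b 0ℚ
  P = γ (suc b) X
  Σb = Σ< b (λ k → lam (suc k) * γ (b ∸ k) X)
  faulhaber-split : pb0 + Sb ≡ 1ℚ * P + Σb
  faulhaber-split = trans (sym (Σ-head D0 (λ e → γ b (ℕ→ℚ e)))) (trans (faulhaber b (suc D0)) (Σ-head b (λ k → lam k * γ (suc b ∸ k) X)))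
  tail-0b : tailΛ 0 b X ≡ L
  tail-0b = trans (ℚₚ.+-identityˡ _) (trans (cong (λ t → t * L * 1ℚ) (multinomial-zeroˡ b)) (solve 1 (λ l → con 1ℚ :* l :* con 1ℚ := l) refl L))
  tail-b0 : tailΛ b 0 X ≡ Σb + L
  tail-b0 = cong₂ _+_
    (Σ-ext b (λ u → trans (cong₂ (λ c t → c * lam (suc t) * γ (b ∸ u) X) (multinomial-zeroʳ u) (ℕₚ.+-identityʳ u))
                          (cong (_* γ (b ∸ u) X) (ℚₚ.*-identityˡ (lam (suc u))))))
    (trans (cong₂ (λ c t → c * lam (suc t) * γ (b ∸ b) X) (multinomial-zeroʳ b) (ℕₚ.+-identityʳ b))
      (trans (cong (λ t → 1ℚ * L * γ t X) (ℕₚ.n∸n≡0 b)) (solve 1 (λ l → con 1ℚ :* l :* con 1ℚ := l) refl L)))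

convPow≡convPoly : ∀ a b D0 → convPow a b (suc D0) ≡ convPoly a b (ℕ→ℚ (suc D0))
convPow≡convPoly zero b D0 = convPow≡convPoly-base b D0
convPow≡convPoly (suc a) b D0 = *-cancelˡ-suc a _ _ (begin
  ℕ→ℚ (suc a) * convPow (suc a) b D
    ≡⟨ solve 3 (λ x y z → x := (x :+ y) :- y) refl (ℕ→ℚ (suc a) * convPow (suc a) b D) (ℕ→ℚ (suc b) * convPow a (suc b) D) X ⟩
  (ℕ→ℚ (suc a) * convPow (suc a) b D + ℕ→ℚ (suc b) * convPow a (suc b) D) - ℕ→ℚ (suc b) * convPow a (suc b) D
    ≡⟨ cong₂ (λ u v → u - ℕ→ℚ (suc b) * v) (convPow-recurrence a b D) (convPow≡convPoly a (suc b) D0) ⟩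
  X * convPow a b D - ℕ→ℚ (suc b) * convPoly a (suc b) X
    ≡⟨ cong (λ u → X * u - ℕ→ℚ (suc b) * convPoly a (suc b) X) (convPow≡convPoly a b D0) ⟩
  X * convPoly a b X - ℕ→ℚ (suc b) * convPoly a (suc b) X
    ≡⟨ cong (λ u → u - ℕ→ℚ (suc b) * convPoly a (suc b) X) (sym (convPoly-recurrence a b X)) ⟩
  (ℕ→ℚ (suc a) * convPoly (suc a) b X + ℕ→ℚ (suc b) * convPoly a (suc b) X) - ℕ→ℚ (suc b) * convPoly a (suc b) X
    ≡⟨ solve 2 (λ x y → (x :+ y) :- y := x) refl (ℕ→ℚ (suc a) * convPoly (suc a) b X) (ℕ→ℚ (suc b) * convPoly a (suc b) X) ⟩
  ℕ→ℚ (suc a) * convPoly (suc a) b X ∎)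
  where
  D = suc D0
  X = ℕ→ℚ (suc D0)

record Linear (T : (ℕ → ℚ) → ℚ) : Set where
  field
    respects : ∀ f g → (∀ k → f k ≡ g k) → T f ≡ T g
    additive : ∀ f g → T (λ k → f k + g k) ≡ T f + T g
    homogeneous : ∀ c f → T (λ k → c * f k) ≡ c * T f

  zero-map : T (λ _ → 0ℚ) ≡ 0ℚ
  zero-map = trans (respects _ (λ k → 0ℚ * 0ℚ) (λ _ → refl)) (trans (homogeneous 0ℚ (λ _ → 0ℚ)) (ℚₚ.*-zeroˡ (T (λ _ → 0ℚ))))

  sum : ∀ m (F : ℕ → ℕ → ℚ) → T (λ k → Σ< m (λ i → F i k)) ≡ Σ< m (λ i → T (F i))
  sum zero    F = zero-map
  sum (suc m) F = trans (additive (λ k → Σ< m (λ i → F i k)) (F m)) (cong (_+ T (F m)) (sum m F))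

·ₛ-linear : ∀ (Y : Series) N → Linear (λ f → (f ·ₛ Y) N)
·ₛ-linear Y N = record
  { respects    = λ f g f≡g → ·-congˡ N Y f≡g
  ; additive    = λ f g → ·-+ˡ N f g Y
  ; homogeneous = λ c f → ·-*ˡ N c f Y
  }

dilate-linear : ∀ n K → Linear (λ g → dilate n g K)
dilate-linear n K = record
  { respects    = λ g h g≡h → dilate-cong n g h K (λ d → g≡h (suc d))
  ; additive    = λ g h → dilate-+ n g h K
  ; homogeneous = λ c g → dilate-* n c g K
  }

-- The diamond product z_{s₁,r₁} ◇ z_{s₂,r₂} is κ times a combination of the
-- letters z_{j,r} with r = r₁ + r₂ - 1.  form F applies the same linear
-- combination to F evaluated at the letter indices (j , r - 1).

module Diamond (s₁ r₁ s₂ r₂ : ℕ) where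

  r : ℕ
  r = r₁ ℕ.+ r₂ ∸ 1

  κ : ℚ
  κ = ℕ→ℚ ((r₁ ℕ.+ r₂ ∸ 2) C (r₁ ∸ 1))

  coeff₁ : ℕ → ℚ
  coeff₁ i = (signPow (s₂ ∸ 1) * ℕ→ℚ ((s₁ ℕ.+ s₂ ∸ suc i ∸ 1) C (s₁ ∸ suc i))) * lam (s₁ ℕ.+ s₂ ∸ suc i)

  coeff₂ : ℕ → ℚ
  coeff₂ i = (signPow (s₁ ∸ 1) * ℕ→ℚ ((s₁ ℕ.+ s₂ ∸ suc i ∸ 1) C (s₂ ∸ suc i))) * lam (s₁ ℕ.+ s₂ ∸ suc i)

  combination : (ℕ → ℚ) → ℚ
  combination F = 1ℚ * F (s₁ ℕ.+ s₂) + (Σ< s₁ (λ i → coeff₁ i * F (suc i)) + Σ< s₂ (λ i → coeff₂ i * F (suc i)))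

  form : (ℕ × ℕ → ℚ) → ℚ
  form F = κ * combination (λ s → F (s , r ∸ 1))

  form-cong : ∀ F G → (∀ s → F (s , r ∸ 1) ≡ G (s , r ∸ 1)) → form F ≡ form G
  form-cong F G F≡G = cong₂ (λ x y → κ * (1ℚ * x + y)) (F≡G (s₁ ℕ.+ s₂))
    (cong₂ _+_ (Σ-ext s₁ (λ i → cong (coeff₁ i *_) (F≡G (suc i)))) (Σ-ext s₂ (λ i → cong (coeff₂ i *_) (F≡G (suc i)))))

  form-commute : ∀ {T} → Linear T → ∀ (G : ℕ × ℕ → ℕ → ℚ) →
                 T (λ K → form (λ sr → G sr K)) ≡ form (λ sr → T (G sr))
  form-commute {T} lin G = begin
    T (λ K → κ * (1ℚ * g₀ K + (Σ₁ K + Σ₂ K)))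
      ≡⟨ homogeneous κ _ ⟩
    κ * T (λ K → 1ℚ * g₀ K + (Σ₁ K + Σ₂ K))
      ≡⟨ cong (κ *_) (trans (additive _ _) (cong₂ _+_ (homogeneous 1ℚ g₀) (trans (additive Σ₁ Σ₂)
           (cong₂ _+_ (trans (sum s₁ (λ i K → coeff₁ i * G (suc i , r ∸ 1) K)) (Σ-ext s₁ (λ i → homogeneous (coeff₁ i) _)))
                      (trans (sum s₂ (λ i K → coeff₂ i * G (suc i , r ∸ 1) K)) (Σ-ext s₂ (λ i → homogeneous (coeff₂ i) _))))))) ⟩
    form (λ sr → T (G sr)) ∎
    where
    open Linear lin
    g₀ : ℕ → ℚ
    g₀ = G (s₁ ℕ.+ s₂ , r ∸ 1)
    Σ₁ Σ₂ : ℕ → ℚ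
    Σ₁ K = Σ< s₁ (λ i → coeff₁ i * G (suc i , r ∸ 1) K)
    Σ₂ K = Σ< s₂ (λ i → coeff₂ i * G (suc i , r ∸ 1) K)

  form-+ : ∀ F G → form (λ x → F x + G x) ≡ form F + form G
  form-+ F G = begin
    κ * (1ℚ * (F e₀ + G e₀) + (Σ< s₁ (λ i → coeff₁ i * (F (f i) + G (f i))) + Σ< s₂ (λ i → coeff₂ i * (F (f i) + G (f i)))))
      ≡⟨ cong (λ x → κ * (1ℚ * (F e₀ + G e₀) + x)) (cong₂ _+_
           (trans (Σ-ext s₁ (λ i → ℚₚ.*-distribˡ-+ (coeff₁ i) (F (f i)) (G (f i)))) (Σ-+ s₁ _ _))
           (trans (Σ-ext s₂ (λ i → ℚₚ.*-distribˡ-+ (coeff₂ i) (F (f i)) (G (f i)))) (Σ-+ s₂ _ _))) ⟩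
    κ * (1ℚ * (F e₀ + G e₀) + ((A₁ + B₁) + (A₂ + B₂)))
      ≡⟨ solve 7 (λ k f g a b c d → k :* (con 1ℚ :* (f :+ g) :+ ((a :+ b) :+ (c :+ d)))
                    := k :* (con 1ℚ :* f :+ (a :+ c)) :+ k :* (con 1ℚ :* g :+ (b :+ d))) refl κ (F e₀) (G e₀) A₁ B₁ A₂ B₂ ⟩
    form F + form G ∎
    where
    e₀ = (s₁ ℕ.+ s₂ , r ∸ 1)
    f : ℕ → ℕ × ℕ
    f i = (suc i , r ∸ 1)
    A₁ = Σ< s₁ (λ i → coeff₁ i * F (f i))
    B₁ = Σ< s₁ (λ i → coeff₁ i * G (f i))
    A₂ = Σ< s₂ (λ i → coeff₂ i * F (f i))
    B₂ = Σ< s₂ (λ i → coeff₂ i * G (f i))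

  form-scale : ∀ c F → form (λ x → c * F x) ≡ c * form F
  form-scale c F = begin
    κ * (1ℚ * (c * F e₀) + (Σ< s₁ (λ i → coeff₁ i * (c * F (f i))) + Σ< s₂ (λ i → coeff₂ i * (c * F (f i)))))
      ≡⟨ cong (λ t → κ * (1ℚ * (c * F e₀) + t)) (cong₂ _+_
           (trans (Σ-ext s₁ (λ i → solve 3 (λ a c f → a :* (c :* f) := c :* (a :* f)) refl (coeff₁ i) c (F (f i)))) (Σ-*ˡ s₁ c _))
           (trans (Σ-ext s₂ (λ i → solve 3 (λ a c f → a :* (c :* f) := c :* (a :* f)) refl (coeff₂ i) c (F (f i)))) (Σ-*ˡ s₂ c _))) ⟩
    κ * (1ℚ * (c * F e₀) + (c * A₁ + c * A₂))
      ≡⟨ solve 5 (λ k c f a b → k :* (con 1ℚ :* (c :* f) :+ (c :* a :+ c :* b)) := c :* (k :* (con 1ℚ :* f :+ (a :+ b))))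
           refl κ c (F e₀) A₁ A₂ ⟩
    c * form F ∎
    where
    e₀ = (s₁ ℕ.+ s₂ , r ∸ 1)
    f : ℕ → ℕ × ℕ
    f i = (suc i , r ∸ 1)
    A₁ = Σ< s₁ (λ i → coeff₁ i * F (f i))
    A₂ = Σ< s₂ (λ i → coeff₂ i * F (f i))

  form-zero : ∀ F → (∀ x → F x ≡ 0ℚ) → form F ≡ 0ℚ
  form-zero F F≡0 = begin
    form F                         ≡⟨ form-cong F (λ x → 0ℚ * F x) (λ s → trans (F≡0 (s , r ∸ 1)) (sym (ℚₚ.*-zeroˡ (F (s , r ∸ 1))))) ⟩
    form (λ x → 0ℚ * F x)          ≡⟨ form-scale 0ℚ F ⟩
    0ℚ * form F                    ≡⟨ ℚₚ.*-zeroˡ (form F) ⟩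
    0ℚ                             ∎

evalConcat-diamond : ∀ a p b q X M N →
  evalConcat (z (suc a) (suc p) ◇ z (suc b) (suc q)) X M N ≡
  Diamond.form (suc a) (suc p) (suc b) (suc q) (λ sr → evalPrefixed sr X M N)
evalConcat-diamond a p b q X M N =
  trans (evalConcat-scale κ P X M N)
  (trans (cong (λ x → κ * (1ℚ * evalTrunc (prefixWith (e₀ ∷ []) X) M N + x)) (evalConcat-++ A B X M N))
   (cong₂ (λ x y → κ * (1ℚ * x + y)) (evalTrunc-prefix e₀ _ (λ d v → refl) X M N)
          (cong₂ _+_ (evalConcat-family (suc a) coeff₁ e (λ x → x) X M N)
                     (evalConcat-family (suc b) coeff₂ e (λ x → x) X M N))))
  where
  open Diamond (suc a) (suc p) (suc b) (suc q)
  instance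
    r-nonZero : NonZero (p ℕ.+ suc q)
    r-nonZero = ℕ.≢-nonZero (λ eq → ℕₚ.1+n≢0 (trans (sym (ℕₚ.+-suc p q)) eq))
  e₀ : Letter
  e₀ = z (suc a ℕ.+ suc b) (p ℕ.+ suc q)
  e : ℕ → Letter
  e i = z (suc i) (p ℕ.+ suc q)
  A = map (λ i → (coeff₁ i , e i ∷ [])) (upTo (suc a))
  B = map (λ i → (coeff₂ i , e i ∷ [])) (upTo (suc b))
  P : Poly
  P = (1ℚ , e₀ ∷ []) ∷ (A ++ B)

-- Both sides are dilations by n, so this reduces to an identity between
-- convolutions of weights, which splits as (powers of n) × (convolution of
-- divided powers in d), the latter being convPow≡convPoly.

levelFactor : ℕ → ℕ → ℚ
levelFactor n r = ℕ→ℚ (n ℕ.^ r) * invFact r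

weight-factor : ∀ s r n d → weight (s , r) n d ≡ levelFactor n r * γ (s ∸ 1) (ℕ→ℚ d)
weight-factor s r n d = trans (cong (λ t → (ℕ→ℚ (n ℕ.^ r) * t) * (invFact r * invFact (s ∸ 1))) (ℕ→ℚ-^ d (s ∸ 1)))
  (solve 4 (λ a b c e → (a :* b) :* (c :* e) := (a :* c) :* (b :* e)) refl
     (ℕ→ℚ (n ℕ.^ r)) (pow (ℕ→ℚ d) (s ∸ 1)) (invFact r) (invFact (s ∸ 1)))

levelFactor-product : ∀ n ρ₁ ρ₂ →
  levelFactor n (ρ₁ ℕ.+ suc ρ₂ ∸ 1) * ℕ→ℚ ((ρ₁ ℕ.+ suc ρ₂ ∸ 1) C ρ₁) ≡ levelFactor n ρ₁ * levelFactor n ρ₂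
levelFactor-product n ρ₁ ρ₂ = begin
  levelFactor n (ρ₁ ℕ.+ suc ρ₂ ∸ 1) * ℕ→ℚ ((ρ₁ ℕ.+ suc ρ₂ ∸ 1) C ρ₁)
    ≡⟨ cong (λ k → levelFactor n (k ∸ 1) * ℕ→ℚ ((k ∸ 1) C ρ₁)) (ℕₚ.+-suc ρ₁ ρ₂) ⟩
  levelFactor n ρ * ℕ→ℚ (ρ C ρ₁)
    ≡⟨ cong₂ (λ u v → u * invFact ρ * v) (trans (cong ℕ→ℚ (ℕₚ.^-distribˡ-+-* n ρ₁ ρ₂)) (ℕ→ℚ-* (n ℕ.^ ρ₁) (n ℕ.^ ρ₂)))
                                        (choose≡multinomial ρ₁ ρ₂) ⟩
  (ℕ→ℚ (n ℕ.^ ρ₁) * ℕ→ℚ (n ℕ.^ ρ₂)) * invFact ρ * (ℕ→ℚ (ρ !) * invFact ρ₁ * invFact ρ₂)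
    ≡⟨ solve 6 (λ a b i f j k → (a :* b) :* i :* (f :* j :* k) := (a :* j) :* (b :* k) :* (i :* f)) refl
         (ℕ→ℚ (n ℕ.^ ρ₁)) (ℕ→ℚ (n ℕ.^ ρ₂)) (invFact ρ) (ℕ→ℚ (ρ !)) (invFact ρ₁) (invFact ρ₂) ⟩
  levelFactor n ρ₁ * levelFactor n ρ₂ * (invFact ρ * ℕ→ℚ (ρ !))
    ≡⟨ cong (levelFactor n ρ₁ * levelFactor n ρ₂ *_) (invFact-! ρ) ⟩
  levelFactor n ρ₁ * levelFactor n ρ₂ * 1ℚ
    ≡⟨ ℚₚ.*-identityʳ _ ⟩
  levelFactor n ρ₁ * levelFactor n ρ₂ ∎
  where
  ρ = ρ₁ ℕ.+ ρ₂

-- (-1)^b Λ a b X, reversed and with the multinomial written as a binomial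
-- coefficient: the shape of the coefficients of the diamond product, with
-- n standing for s₁ + s₂ - 1.
signed-tail : ∀ a b n X → n ≡ a ℕ.+ suc b →
  signPow b * tailΛ a b X ≡ Σ< (suc a) (λ i → (signPow b * ℕ→ℚ ((n ∸ i ∸ 1) C (a ∸ i))) * lam (n ∸ i) * γ i X)
signed-tail a b n X n≡ = begin
  signPow b * tailΛ a b X
    ≡⟨ cong (signPow b *_) (Σ-reverse (suc a) _) ⟩
  signPow b * Σ< (suc a) (λ i → multinomial (a ∸ i) b * lam (suc (a ∸ i ℕ.+ b)) * γ (a ∸ (a ∸ i)) X)
    ≡⟨ sym (Σ-*ˡ (suc a) (signPow b) _) ⟩
  Σ< (suc a) (λ i → signPow b * (multinomial (a ∸ i) b * lam (suc (a ∸ i ℕ.+ b)) * γ (a ∸ (a ∸ i)) X))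
    ≡⟨ Σ-cong (suc a) (λ i i≤a → sym (term i (ℕₚ.≤-pred i≤a))) ⟩
  Σ< (suc a) (λ i → (signPow b * ℕ→ℚ ((n ∸ i ∸ 1) C (a ∸ i))) * lam (n ∸ i) * γ i X) ∎
  where
  index : ∀ i → i ≤ a → n ∸ i ≡ suc (a ∸ i ℕ.+ b)
  index i i≤a = trans (cong (_∸ i) n≡) (trans (ℕₚ.+-∸-comm (suc b) i≤a) (ℕₚ.+-suc (a ∸ i) b))
  term : ∀ i → i ≤ a → (signPow b * ℕ→ℚ ((n ∸ i ∸ 1) C (a ∸ i))) * lam (n ∸ i) * γ i X ≡
                       signPow b * (multinomial (a ∸ i) b * lam (suc (a ∸ i ℕ.+ b)) * γ (a ∸ (a ∸ i)) X)
  term i i≤a = begin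
    (signPow b * ℕ→ℚ ((n ∸ i ∸ 1) C (a ∸ i))) * lam (n ∸ i) * γ i X
      ≡⟨ cong (λ k → (signPow b * ℕ→ℚ ((k ∸ 1) C (a ∸ i))) * lam k * γ i X) (index i i≤a) ⟩
    (signPow b * ℕ→ℚ ((a ∸ i ℕ.+ b) C (a ∸ i))) * lam (suc (a ∸ i ℕ.+ b)) * γ i X
      ≡⟨ cong₂ (λ c t → (signPow b * c) * lam (suc (a ∸ i ℕ.+ b)) * t) (choose≡multinomial (a ∸ i) b)
                                                                       (cong (λ k → γ k X) (sym (ℕₚ.m∸[m∸n]≡n i≤a))) ⟩
    (signPow b * multinomial (a ∸ i) b) * lam (suc (a ∸ i ℕ.+ b)) * γ (a ∸ (a ∸ i)) X
      ≡⟨ solve 4 (λ s c l q → (s :* c) :* l :* q := s :* (c :* l :* q)) refl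
           (signPow b) (multinomial (a ∸ i) b) (lam (suc (a ∸ i ℕ.+ b))) (γ (a ∸ (a ∸ i)) X) ⟩
    signPow b * (multinomial (a ∸ i) b * lam (suc (a ∸ i ℕ.+ b)) * γ (a ∸ (a ∸ i)) X) ∎

convPoly≡combination : ∀ a b r₁ r₂ X →
  convPoly a b X ≡ Diamond.combination (suc a) r₁ (suc b) r₂ (λ s → γ (s ∸ 1) X)
convPoly≡combination a b r₁ r₂ X = begin
  γ (suc (a ℕ.+ b)) X + signPow b * tailΛ a b X + signPow a * tailΛ b a X
    ≡⟨ cong₂ (λ u v → u + v + signPow a * tailΛ b a X) (cong (λ k → γ k X) (sym (ℕₚ.+-suc a b)))
                                                       (signed-tail a b (a ℕ.+ suc b) X refl) ⟩
  γ (a ℕ.+ suc b) X + Σ₁ + signPow a * tailΛ b a X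
    ≡⟨ cong (γ (a ℕ.+ suc b) X + Σ₁ +_)
         (signed-tail b a (a ℕ.+ suc b) X (trans (ℕₚ.+-suc a b) (trans (cong suc (ℕₚ.+-comm a b)) (sym (ℕₚ.+-suc b a))))) ⟩
  γ (a ℕ.+ suc b) X + Σ₁ + Σ₂
    ≡⟨ solve 3 (λ P x y → P :+ x :+ y := con 1ℚ :* P :+ (x :+ y)) refl (γ (a ℕ.+ suc b) X) Σ₁ Σ₂ ⟩
  1ℚ * γ (a ℕ.+ suc b) X + (Σ₁ + Σ₂) ∎
  where
  open Diamond (suc a) r₁ (suc b) r₂
  Σ₁ = Σ< (suc a) (λ i → coeff₁ i * γ i X)
  Σ₂ = Σ< (suc b) (λ i → coeff₂ i * γ i X)

convolution-weight : ∀ a ρ₁ b ρ₂ n d →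
  convolution (weight (suc a , ρ₁) n) (weight (suc b , ρ₂) n) (suc d) ≡
  Diamond.form (suc a) (suc ρ₁) (suc b) (suc ρ₂) (λ sr → weight sr n (suc d))
convolution-weight a ρ₁ b ρ₂ n d = begin
  Σ< d (λ e → weight (suc a , ρ₁) n (suc e) * weight (suc b , ρ₂) n (d ∸ e))
    ≡⟨ Σ-ext d (λ e → trans (cong₂ _*_ (weight-factor (suc a) ρ₁ n (suc e)) (weight-factor (suc b) ρ₂ n (d ∸ e)))
         (solve 4 (λ A P B Q → (A :* P) :* (B :* Q) := (A :* B) :* (P :* Q)) refl
            (levelFactor n ρ₁) (γ a (ℕ→ℚ (suc e))) (levelFactor n ρ₂) (γ b (ℕ→ℚ (d ∸ e))))) ⟩
  Σ< d (λ e → (levelFactor n ρ₁ * levelFactor n ρ₂) * (γ a (ℕ→ℚ (suc e)) * γ b (ℕ→ℚ (d ∸ e))))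
    ≡⟨ Σ-*ˡ d (levelFactor n ρ₁ * levelFactor n ρ₂) _ ⟩
  (levelFactor n ρ₁ * levelFactor n ρ₂) * convPow a b (suc d)
    ≡⟨ cong ((levelFactor n ρ₁ * levelFactor n ρ₂) *_)
         (trans (convPow≡convPoly a b d) (convPoly≡combination a b (suc ρ₁) (suc ρ₂) X)) ⟩
  (levelFactor n ρ₁ * levelFactor n ρ₂) * Γ
    ≡⟨ cong (_* Γ) (sym (levelFactor-product n ρ₁ ρ₂)) ⟩
  (levelFactor n R * κ) * Γ
    ≡⟨ ℚₚ.*-assoc (levelFactor n R) κ Γ ⟩
  levelFactor n R * form (λ sr → γ (proj₁ sr ∸ 1) X)
    ≡⟨ sym (form-scale (levelFactor n R) (λ sr → γ (proj₁ sr ∸ 1) X)) ⟩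
  form (λ sr → levelFactor n R * γ (proj₁ sr ∸ 1) X)
    ≡⟨ form-cong (λ sr → levelFactor n R * γ (proj₁ sr ∸ 1) X) (λ sr → weight sr n (suc d))
                 (λ s → sym (weight-factor s R n (suc d))) ⟩
  form (λ sr → weight sr n (suc d)) ∎
  where
  open Diamond (suc a) (suc ρ₁) (suc b) (suc ρ₂)
  X = ℕ→ℚ (suc d)
  R = r ∸ 1
  Γ = combination (λ s → γ (s ∸ 1) X)

level-product : ∀ a ρ₁ b ρ₂ M K →
  (level (suc a , ρ₁) (suc M) ·ₛ level (suc b , ρ₂) (suc M)) K ≡
  Diamond.form (suc a) (suc ρ₁) (suc b) (suc ρ₂) (λ sr → level sr (suc M) K)
level-product a ρ₁ b ρ₂ M K = begin
  (level (suc a , ρ₁) n ·ₛ level (suc b , ρ₂) n) K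
    ≡⟨ dilate-product M (weight (suc a , ρ₁) n) (weight (suc b , ρ₂) n) K ⟩
  dilate n (convolution (weight (suc a , ρ₁) n) (weight (suc b , ρ₂) n)) K
    ≡⟨ dilate-cong n (convolution (weight (suc a , ρ₁) n) (weight (suc b , ρ₂) n)) (λ D → form (λ sr → weight sr n D)) K
                   (convolution-weight a ρ₁ b ρ₂ n) ⟩
  dilate n (λ D → form (λ sr → weight sr n D)) K
    ≡⟨ form-commute (dilate-linear n K) (λ sr → weight sr n) ⟩
  form (λ sr → level sr n K) ∎
  where
  open Diamond (suc a) (suc ρ₁) (suc b) (suc ρ₂)
  n = suc M

-- The proof is by induction on
-- the words and then on M; each step from M to M+1 adds the terms with
-- largest index n₁ = M, and these match because of level-product.

MultiplicativeAt : Word → Word → Set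
MultiplicativeAt w v = ∀ M N → evalTrunc (stuffleW w v) M N ≡ (bracketW w M ·ₛ bracketW v M) N

·-expand : ∀ N (a x b y : Series) →
  ((λ K → a K + x K) ·ₛ (λ K → b K + y K)) N ≡ (a ·ₛ b) N + (((x ·ₛ b) N + (a ·ₛ y) N) + (x ·ₛ y) N)
·-expand N a x b y = begin
  ((λ K → a K + x K) ·ₛ B′) N
    ≡⟨ trans (·-+ˡ N a x B′) (cong₂ _+_ (·-+ʳ N b y a) (·-+ʳ N b y x)) ⟩
  ((a ·ₛ b) N + (a ·ₛ y) N) + ((x ·ₛ b) N + (x ·ₛ y) N)
    ≡⟨ solve 4 (λ p q r t → (p :+ q) :+ (r :+ t) := p :+ ((r :+ q) :+ t)) refl
         ((a ·ₛ b) N) ((a ·ₛ y) N) ((x ·ₛ b) N) ((x ·ₛ y) N) ⟩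
  (a ·ₛ b) N + (((x ·ₛ b) N + (a ·ₛ y) N) + (x ·ₛ y) N) ∎
  where
  B′ : Series
  B′ K = b K + y K

·-interchange : ∀ N (s t w v : Series) → ((s ·ₛ t) ·ₛ (w ·ₛ v)) N ≡ ((s ·ₛ w) ·ₛ (t ·ₛ v)) N
·-interchange N s t w v = begin
  ((s ·ₛ t) ·ₛ (w ·ₛ v)) N   ≡⟨ ·-assoc N s t (w ·ₛ v) ⟩
  (s ·ₛ (t ·ₛ (w ·ₛ v))) N   ≡⟨ ·-congʳ N s (λ K → sym (·-assoc K t w v)) ⟩
  (s ·ₛ ((t ·ₛ w) ·ₛ v)) N   ≡⟨ ·-congʳ N s (λ K → ·-congˡ K v (λ J → ·-comm J t w)) ⟩
  (s ·ₛ ((w ·ₛ t) ·ₛ v)) N   ≡⟨ ·-congʳ N s (λ K → ·-assoc K w t v) ⟩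
  (s ·ₛ (w ·ₛ (t ·ₛ v))) N   ≡⟨ sym (·-assoc N s w (t ·ₛ v)) ⟩
  ((s ·ₛ w) ·ₛ (t ·ₛ v)) N   ∎

module StuffleStep (a p b q : ℕ) (w v : Word) where

  za zb : Letter
  za = z (suc a) (suc p)
  zb = z (suc b) (suc q)

  X₁ X₂ X₃ : Poly
  X₁ = stuffleW w (zb ∷ v)
  X₂ = stuffleW (za ∷ w) v
  X₃ = stuffleW w v

  open Diamond (suc a) (suc p) (suc b) (suc q) using (form; form-cong; form-+; form-commute; form-zero)

  split : ℕ → Series
  split M N = evalPrefixed (suc a , p) X₁ M N + (evalPrefixed (suc b , q) X₂ M N + form (λ sr → evalPrefixed sr X₃ M N))

  unfold : ∀ M N → evalTrunc (stuffleW (za ∷ w) (zb ∷ v)) M N ≡ split M N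
  unfold M N =
    trans (evalTrunc-++ (prepend za X₁) _ M N)
     (cong₂ _+_ (evalTrunc-prefix za _ (λ d u → refl) X₁ M N)
       (trans (evalTrunc-++ (prepend zb X₂) _ M N)
         (cong₂ _+_ (evalTrunc-prefix zb _ (λ d u → refl) X₂ M N)
           (trans (evalTrunc-·ᶜ (za ◇ zb) X₃ M N) (evalConcat-diamond a p b q X₃ M N)))))

  split-low : ∀ M N → M ≤ 1 → split M N ≡ 0ℚ
  split-low M N M≤1 =
    trans (cong₂ _+_ (evalPrefixed-low _ X₁ M N M≤1)
                     (cong₂ _+_ (evalPrefixed-low _ X₂ M N M≤1) (form-zero _ (λ sr → evalPrefixed-low sr X₃ M N M≤1))))
          (solve 0 (con 0ℚ :+ (con 0ℚ :+ con 0ℚ) := con 0ℚ) refl)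

  split-step : ∀ M N → let m = suc M; σa = level (suc a , p) m; σb = level (suc b , q) m in
    split (suc m) N ≡ split m N + (((σa ·ₛ evalTrunc X₁ m) N + (σb ·ₛ evalTrunc X₂ m) N) + ((σa ·ₛ σb) ·ₛ evalTrunc X₃ m) N)
  split-step M N = begin
    split (suc m) N
      ≡⟨ cong₂ _+_ (evalPrefixed-step _ X₁ M N) (cong₂ _+_ (evalPrefixed-step _ X₂ M N) diamond-step) ⟩
    (E₁ + S₁) + ((E₂ + S₂) + (E₃ + S₃))
      ≡⟨ solve 6 (λ e₁ e₂ e₃ x y u → (e₁ :+ x) :+ ((e₂ :+ y) :+ (e₃ :+ u)) := (e₁ :+ (e₂ :+ e₃)) :+ ((x :+ y) :+ u)) refl
           E₁ E₂ E₃ S₁ S₂ S₃ ⟩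
    split m N + ((S₁ + S₂) + S₃) ∎
    where
    m = suc M
    σa = level (suc a , p) m
    σb = level (suc b , q) m
    E₁ = evalPrefixed (suc a , p) X₁ m N
    E₂ = evalPrefixed (suc b , q) X₂ m N
    E₃ = form (λ sr → evalPrefixed sr X₃ m N)
    S₁ = (σa ·ₛ evalTrunc X₁ m) N
    S₂ = (σb ·ₛ evalTrunc X₂ m) N
    S₃ = ((σa ·ₛ σb) ·ₛ evalTrunc X₃ m) N
    diamond-step : form (λ sr → evalPrefixed sr X₃ (suc m) N) ≡ E₃ + S₃
    diamond-step = begin
      form (λ sr → evalPrefixed sr X₃ (suc m) N)
        ≡⟨ form-cong (λ sr → evalPrefixed sr X₃ (suc m) N) (λ sr → evalPrefixed sr X₃ m N + (level sr m ·ₛ evalTrunc X₃ m) N)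
                     (λ s → evalPrefixed-step _ X₃ M N) ⟩
      form (λ sr → evalPrefixed sr X₃ m N + (level sr m ·ₛ evalTrunc X₃ m) N)
        ≡⟨ form-+ (λ sr → evalPrefixed sr X₃ m N) (λ sr → (level sr m ·ₛ evalTrunc X₃ m) N) ⟩
      E₃ + form (λ sr → (level sr m ·ₛ evalTrunc X₃ m) N)
        ≡⟨ cong (E₃ +_) (sym (trans (·-congˡ N (evalTrunc X₃ m) (level-product a p b q M))
                                    (form-commute (·ₛ-linear (evalTrunc X₃ m) N) (λ sr → level sr m)))) ⟩
      E₃ + S₃ ∎

  -- For M ≤ 1 both sides vanish: there is no n₁ with 0 < n₁ < M.
  multiplicative-low : ∀ M N → M ≤ 1 →
    evalTrunc (stuffleW (za ∷ w) (zb ∷ v)) M N ≡ (bracketW (za ∷ w) M ·ₛ bracketW (zb ∷ v) M) N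
  multiplicative-low M N M≤1 = trans (unfold M N) (trans (split-low M N M≤1)
    (sym (·-zeroˡ N (bracketW (za ∷ w) M) (bracketW (zb ∷ v) M) (empty M≤1))))
    where
    empty : M ≤ 1 → ∀ K → bracketW (za ∷ w) M K ≡ 0ℚ
    empty z≤n       K = refl
    empty (s≤s z≤n) K = refl

  multiplicative : (∀ u → MultiplicativeAt w u) → MultiplicativeAt (za ∷ w) v → MultiplicativeAt (za ∷ w) (zb ∷ v)
  multiplicative IH-w IH-v zero          N = multiplicative-low 0 N z≤n
  multiplicative IH-w IH-v (suc zero)    N = multiplicative-low 1 N (s≤s z≤n)
  multiplicative IH-w IH-v (suc (suc M′)) N = begin
    evalTrunc (stuffleW (za ∷ w) (zb ∷ v)) (suc m) N
      ≡⟨ unfold (suc m) N ⟩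
    split (suc m) N
      ≡⟨ split-step M′ N ⟩
    split m N + (((σa ·ₛ evalTrunc X₁ m) N + (σb ·ₛ evalTrunc X₂ m) N) + ((σa ·ₛ σb) ·ₛ evalTrunc X₃ m) N)
      ≡⟨ cong₂ _+_ (trans (sym (unfold m N)) (multiplicative IH-w IH-v (suc M′) N))
                   (cong₂ _+_ (cong₂ _+_ first-letter second-letter) both-letters) ⟩
    (A ·ₛ B) N + ((((σa ·ₛ W) ·ₛ B) N + (A ·ₛ (σb ·ₛ V)) N) + ((σa ·ₛ W) ·ₛ (σb ·ₛ V)) N)
      ≡⟨ sym (·-expand N A (σa ·ₛ W) B (σb ·ₛ V)) ⟩
    ((λ K → A K + (σa ·ₛ W) K) ·ₛ (λ K → B K + (σb ·ₛ V) K)) N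
      ≡⟨ ·-cong N (λ K → sym (bracket-step (suc a) p (map letterIdx w) M′ K))
                  (λ K → sym (bracket-step (suc b) q (map letterIdx v) M′ K)) ⟩
    (bracketW (za ∷ w) (suc m) ·ₛ bracketW (zb ∷ v) (suc m)) N ∎
    where
    m = suc M′
    σa = level (suc a , p) m
    σb = level (suc b , q) m
    A = bracketW (za ∷ w) m
    B = bracketW (zb ∷ v) m
    W = bracketW w m
    V = bracketW v m
    first-letter : (σa ·ₛ evalTrunc X₁ m) N ≡ ((σa ·ₛ W) ·ₛ B) N
    first-letter = trans (·-congʳ N σa (IH-w (zb ∷ v) m)) (sym (·-assoc N σa W B))
    second-letter : (σb ·ₛ evalTrunc X₂ m) N ≡ (A ·ₛ (σb ·ₛ V)) N
    second-letter = begin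
      (σb ·ₛ evalTrunc X₂ m) N ≡⟨ ·-congʳ N σb (λ K → trans (IH-v m K) (·-comm K A V)) ⟩
      (σb ·ₛ (V ·ₛ A)) N       ≡⟨ sym (·-assoc N σb V A) ⟩
      ((σb ·ₛ V) ·ₛ A) N       ≡⟨ ·-comm N (σb ·ₛ V) A ⟩
      (A ·ₛ (σb ·ₛ V)) N       ∎
    both-letters : ((σa ·ₛ σb) ·ₛ evalTrunc X₃ m) N ≡ ((σa ·ₛ W) ·ₛ (σb ·ₛ V)) N
    both-letters = trans (·-congʳ N (σa ·ₛ σb) (IH-w v m)) (·-interchange N σa σb W V)

stuffle-multiplicative : ∀ w v → MultiplicativeAt w v
stuffle-multiplicative []      v M N =
  trans (trans (ℚₚ.+-identityʳ _) (ℚₚ.*-identityˡ _)) (sym (·-unitˡ N (bracketW v M)))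
stuffle-multiplicative (x ∷ w) v = with-left x w (stuffle-multiplicative w) v
  where
  with-left : ∀ x w → (∀ u → MultiplicativeAt w u) → ∀ v → MultiplicativeAt (x ∷ w) v
  with-left x w IH-w []      M N =
    trans (trans (ℚₚ.+-identityʳ _) (ℚₚ.*-identityˡ _)) (sym (·-unitʳ N (bracketW (x ∷ w) M)))
  with-left (z zero r {{()}})            w IH-w (y ∷ v)
  with-left (z (suc a) zero {{_}} {{()}}) w IH-w (y ∷ v)
  with-left (z (suc a) (suc p)) w IH-w (z zero r {{()}} ∷ v)
  with-left (z (suc a) (suc p)) w IH-w (z (suc b) zero {{_}} {{()}} ∷ v)
  with-left (z (suc a) (suc p)) w IH-w (z (suc b) (suc q) ∷ v) =
    StuffleStep.multiplicative a p b q w v IH-w (with-left (z (suc a) (suc p)) w IH-w v)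

multiplicative-on-words : ∀ w v N → eval (stuffleW w v) N ≡ (evalW w ·ₛ evalW v) N
multiplicative-on-words w v N =
  trans (eval≡evalTrunc (stuffleW w v) N)
   (trans (stuffle-multiplicative w v (suc N) N)
     (·-congᵇ N (λ k k≤N → bracket-bound (map letterIdx w) (suc N) k (s≤s k≤N))
                (λ k k≤N → bracket-bound (map letterIdx v) (suc N) k (s≤s k≤N))))

proposition2 : ∀ (w v : Poly) (N : ℕ) → eval (w ⋆ v) N ≡ (eval w ·ₛ eval v) N
proposition2 = multiplicative-on-polynomials multiplicative-on-words
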